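{- The formal power series $D_I$ and $D_S$ in the variables $x_1,x_2,\dots$ satisfy $$D_I(x_1,x_2,\dots)=\frac{1+x_1-x_1x_2+x_1x_2\,D_I(x_1,\,x_2x_3,\,x_3x_4,\dots)}{1-x_1^2+x_1^2x_2^2-x_1^2x_2^2\,D_S(x_1^2,\,x_2^2x_3^2,\,x_3^2x_4^2,\dots)}.$$
   Context: For a permutation $\pi$ of length $n$, let $\sharp1(\pi)=n$, and for $k\geq2$ let $\sharp(12\text{ - }3\text{ - }\cdots\text{ - }k)(\pi)$ be the number of index sets $i_1<i_2<\dots<i_k$ with $i_2=i_1+1$ and $\pi_{i_1}<\pi_{i_2}<\dots<\pi_{i_k}$ (for $k=2$ this is the number of rises). Let $\mathcal{S}(132)$ be the set of all permutations of all lengths (including the empty one) avoiding $132$ (no $i<j<k$ with $\pi_i<\pi_k<\pi_j$), and $\mathcal{I}(132)$ the subset of involutions ($\pi=\pi^{ -1}$). Define $D_I(x_1,x_2,\dots)=\sum_{\pi\in\mathcal{I}(132)}x_1^{\sharp1(\pi)}\prod_{k\geq2}x_k^{\sharp(12\text{ - }3\text{ - }\cdots\text{ - }k)(\pi)}$ and $D_S$ by the same sum over $\mathcal{S}(132)$. $D(y_1,y_2,\dots)$ denotes substitution $x_k\mapsto y_k$. (It is known that $D_S(x_1,x_2,\dots)=1/(1-x_1+x_1x_2-x_1x_2D_S(x_1,x_2x_3,x_3x_4,\dots))$.) -}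

module Defs where

open import Data.Bool using (Bool; true; false; _∧_; _∨_; not; if_then_else_)
open import Data.Nat using (ℕ; zero; suc; _+_; _*_; _∸_; _≡ᵇ_; _<ᵇ_)
open import Data.List using (List; []; _∷_; [_]; map; filter; length; concatMap; upTo; replicate; _++_; zipWith; foldr)
open import Data.Bool.ListAction using (any; all)
open import Data.Integer as ℤ using (ℤ; +_)
open import Relation.Binary.PropositionalEquality using (_≡_)
open import Relation.Nullary.Decidable using (T?)
open import Data.Bool using (T)

-- Permutations (one-line notation, values 0..n-1; only relative order
-- matters for all patterns/statistics used here)

words : ℕ → ℕ → List (List ℕ)
words zero    b = [] ∷ []
words (suc l) b = concatMap (λ v → map (v ∷_) (words l b)) (upTo b)

allDistinct : List ℕ → Bool
allDistinct []       = true
allDistinct (x ∷ xs) = not (any (x ≡ᵇ_) xs) ∧ allDistinct xs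

perms : ℕ → List (List ℕ)
perms n = filter (λ w → T? (allDistinct w)) (words n n)

has32above : ℕ → List ℕ → Bool
has32above a []       = false
has32above a (b ∷ cs) = any (λ c → (a <ᵇ c) ∧ (c <ᵇ b)) cs ∨ has32above a cs

contains132 : List ℕ → Bool
contains132 []       = false
contains132 (a ∷ as) = has32above a as ∨ contains132 as

avoids132 : List ℕ → Bool
avoids132 π = not (contains132 π)

at : ℕ → List ℕ → ℕ
at _       []       = 0
at zero    (x ∷ xs) = x
at (suc i) (x ∷ xs) = at i xs

isInvolution : List ℕ → Bool
isInvolution π = all (λ i → at (at i π) π ≡ᵇ i) (upTo (length π))

incAbove : ℕ → ℕ → List ℕ → ℕ
incAbove zero    v xs       = 1
incAbove (suc c) v []       = 0
incAbove (suc c) v (x ∷ xs) = (if v <ᵇ x then incAbove c x xs else 0) + incAbove (suc c) v xs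

-- ♯(12-3-…-k)(π) for k ≥ 2: occurrences i1<i2<…<ik, i2 = i1+1, increasing values
pat : ℕ → List ℕ → ℕ
pat k (a ∷ b ∷ rest) = (if a <ᵇ b then incAbove (k ∸ 2) b rest else 0) + pat k (b ∷ rest)
pat k _              = 0

-- exponent vector of the monomial of π: entry 0 is the exponent of x_1 (= n),
-- entry k-1 (k ≥ 2) is the exponent of x_k; exponents of x_k for k > n are 0
expVec : List ℕ → List ℕ
expVec π = length π ∷ map (λ j → pat (2 + j) π) (upTo (length π ∸ 1))

-- Monomials in x_1, x_2, … as exponent lists (index 0 ↦ x_1),
-- identified up to trailing zeros

norm : List ℕ → List ℕ
norm []       = []
norm (x ∷ xs) with norm xs
... | []       = if x ≡ᵇ 0 then [] else x ∷ []
... | (y ∷ ys) = x ∷ y ∷ ys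

eqL : List ℕ → List ℕ → Bool
eqL []       []       = true
eqL (x ∷ xs) (y ∷ ys) = (x ≡ᵇ y) ∧ eqL xs ys
eqL _        _        = false

sameMon : List ℕ → List ℕ → Bool
sameMon a b = eqL (norm a) (norm b)

addV : List ℕ → List ℕ → List ℕ
addV []       ys       = ys
addV xs       []       = xs
addV (x ∷ xs) (y ∷ ys) = x + y ∷ addV xs ys

-- a substitution x_k ↦ y_k; y k is the exponent list of the monomial y_{k+1}
Subst : Set
Subst = ℕ → List ℕ

applyMonFrom : Subst → ℕ → List ℕ → List ℕ
applyMonFrom y k []       = []
applyMonFrom y k (a ∷ as) = addV (map (a *_) (y k)) (applyMonFrom y (suc k) as)

applyMon : Subst → List ℕ → List ℕ
applyMon y = applyMonFrom y 0

Series : Set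
Series = List ℕ → ℤ

_≋_ : Series → Series → Set
f ≋ g = ∀ m → f m ≡ g m

monoS : ℤ → List ℕ → Series
monoS c e m = if sameMon e m then c else + 0

oneS : Series
oneS = monoS (+ 1) []

_⊕_ : Series → Series → Series
(f ⊕ g) m = f m ℤ.+ g m

⊖_ : Series → Series
(⊖ f) m = ℤ.- f m

_⊝_ : Series → Series → Series
f ⊝ g = f ⊕ (⊖ g)

divisors : List ℕ → List (List ℕ)
divisors []       = [] ∷ []
divisors (a ∷ m)  = concatMap (λ b → map (b ∷_) (divisors m)) (upTo (suc a))

sumℤ : List ℤ → ℤ
sumℤ = foldr ℤ._+_ (+ 0)

_⊛_ : Series → Series → Series
(f ⊛ g) m = sumℤ (map (λ d → f d ℤ.* g (zipWith _∸_ m d)) (divisors m))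

infixl 6 _⊕_ _⊝_
infixl 7 _⊛_
infix 4 _≋_

-- The generating functions D_P(y_1, y_2, …) = Σ_{π ∈ P} ∏ y_k^{stat_k(π)},
-- over 132-avoiders satisfying an extra property P (true / involution).
-- The coefficient of m sums over lengths n ≤ (exponent of x_1 in m); this is
-- exhaustive for all substitutions used below, since there y_1 ∈ {x_1, x_1²}
-- and the other y_k do not involve x_1.

head0 : List ℕ → ℕ
head0 []      = 0
head0 (x ∷ _) = x

countLen : (List ℕ → Bool) → Subst → List ℕ → ℕ → ℕ
countLen P y m n =
  length (filter (λ π → T? (avoids132 π ∧ P π ∧ sameMon (applyMon y (expVec π)) m)) (perms n))

genSeries : (List ℕ → Bool) → Subst → Series
genSeries P y m = + foldr _+_ 0 (map (countLen P y m) (upTo (suc (head0 m))))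

idSub : Subst
idSub k = replicate k 0 ++ [ 1 ]

-- y_1 = x_1^c, y_k = (x_k x_{k+1})^c for k ≥ 2
pairSub : ℕ → Subst
pairSub c zero    = [ c ]
pairSub c (suc k) = replicate (suc k) 0 ++ (c ∷ c ∷ [])

DI : Subst → Series
DI = genSeries isInvolution

DS : Subst → Series
DS = genSeries (λ _ → true)

X : ℕ → Series   -- X k is the variable x_{k+1}
X k = monoS (+ 1) (idSub k)

module Submission where

-- 132-avoiding permutations are binary trees: a permutation with maximum n is π′ n π″ with every
-- entry of π′ above every entry of π″. The statistics ♯(12-3-…-k) are additive along this
-- decomposition, and inversion of permutations becomes a tree operation, so involutions are the
-- self-inverse trees. A self-inverse tree is a leaf, a root with empty right and self-inverse left
-- subtree α (weight x₁ for α a leaf, x₁x₂ times the weight of α in D_I(x₁, x₂x₃, …) otherwise), or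
-- a bracket of an arbitrary tree a, its inverse and a self-inverse g (weight x₁² times that of g
-- for a a leaf, x₁²x₂² times that of a in D_S(x₁², x₂²x₃², …) times that of g otherwise). Hence
--   D_I = 1 + x₁ + x₁x₂ (D_I(x₁, x₂x₃, …) - 1) + x₁² D_I + x₁²x₂² (D_S(x₁², x₂²x₃², …) - 1) D_I,
-- which rearranges to the theorem. Coefficients are compared monomial by monomial, writing every
-- series involved as a sum of monomials that is finite in each x₁-degree.

open import Defs

open import Algebra.Properties.CommutativeSemigroup as CommSemigroupProperties using ()
open import Data.Bool using (Bool; true; false; T; _∧_; not; if_then_else_)
open import Data.Bool.Properties using (T-∧; T-∨; T-≡)
open import Data.Empty using (⊥-elim)
open import Data.Integer as ℤ using (ℤ; 0ℤ; 1ℤ)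
import Data.Integer.Properties as ℤₚ
import Data.Integer.Solver
open import Data.List using (List; []; _∷_; [_]; map; filter; length; concatMap; upTo; applyUpTo; replicate; _++_; zipWith; foldr)
open import Data.List.Properties
  using (map-∘; map-cong; map-cong-local; map-id; map-id-local; map-++; map-upTo; map-injective; ++-assoc; ∷-injective;
         filter-all; length-map; length-++; length-upTo; length-filter; upTo-∷ʳ)
open import Data.List.Membership.Propositional using (_∈_; _∉_; find; lose)
open import Data.List.Membership.Propositional.Properties
  using (∈-map⁺; ∈-map⁻; ∈-filter⁺; ∈-filter⁻; ∈-upTo⁺; ∈-upTo⁻; ∈-concatMap⁺; ∈-concatMap⁻; ∈-∃++;
         ∈-++⁺ˡ; ∈-++⁺ʳ; ∈-++⁻)
open import Data.List.Membership.Propositional.Properties.WithK using (unique∧set⇒bag)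
open import Data.List.Relation.Binary.BagAndSetEquality using (∼bag⇒↭)
open import Data.List.Relation.Binary.Permutation.Propositional as ↭ using (_↭_)
open import Data.List.Relation.Binary.Permutation.Propositional.Properties using (↭-length)
open import Data.List.Relation.Unary.All as All using (All; []; _∷_)
import Data.List.Relation.Unary.All.Properties as All
open import Data.List.Relation.Unary.AllPairs using ([]; _∷_)
open import Data.List.Relation.Unary.Any as Any using (Any; here; there)
import Data.List.Relation.Unary.Any.Properties as Any
open import Data.List.Relation.Unary.Unique.Propositional using (Unique)
import Data.List.Relation.Unary.Unique.Propositional.Properties as Unique
open import Data.Nat as ℕ using (ℕ; zero; suc; _+_; _*_; _∸_; _≤_; _<_; z≤n; s≤s; _≡ᵇ_; _<ᵇ_; _≤?_)
open import Data.Nat.Induction using (<-rec)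
open import Data.Nat.Properties as ℕₚ using (_≟_)
import Data.Nat.Solver
open import Data.List.Membership.DecPropositional _≟_ using (_∈?_)
open import Data.Product using (∃-syntax; _×_; _,_; proj₁; proj₂)
open import Data.Sum using (_⊎_; inj₁; inj₂)
open import Data.Unit using (⊤; tt)
open import Function using (id; _∘_; _⇔_; mk⇔; Equivalence; Injective)
open import Relation.Binary using (tri<; tri≈; tri>)
open import Relation.Binary.PropositionalEquality
  using (_≡_; _≢_; refl; sym; trans; cong; cong₂; subst; _≗_; module ≡-Reasoning)
open import Relation.Nullary using (¬_; Dec; yes; no; does; _because_)
open import Relation.Nullary.Decidable using (T?)
open import Relation.Nullary.Reflects using (Reflects; ofʸ; ofⁿ; fromEquivalence; ¬-reflects)

private
  module ℕ+ = CommSemigroupProperties ℕₚ.+-commutativeSemigroup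
  module ℤ+ = CommSemigroupProperties ℤₚ.+-commutativeSemigroup
  module ℕ-Solver = Data.Nat.Solver.+-*-Solver
  module ℤ-Solver = Data.Integer.Solver.+-*-Solver

-- Through sumℤ, a coefficient (f ⊛ g) m unfolds to a ∑ over divisors m.
∑ : {A : Set} → List A → (A → ℤ) → ℤ
∑ xs f = sumℤ (map f xs)

infixr 5 ∑
syntax ∑ xs (λ x → e) = ∑[ x ∈ xs ] e

∑-cong-∈ : ∀ {A : Set} (xs : List A) {f g : A → ℤ} → (∀ x → x ∈ xs → f x ≡ g x) → ∑ xs f ≡ ∑ xs g
∑-cong-∈ []       f≡g = refl
∑-cong-∈ (x ∷ xs) f≡g = cong₂ ℤ._+_ (f≡g x (here refl)) (∑-cong-∈ xs (λ y y∈ → f≡g y (there y∈)))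

∑-cong : ∀ {A : Set} (xs : List A) {f g : A → ℤ} → f ≗ g → ∑ xs f ≡ ∑ xs g
∑-cong xs f≗g = ∑-cong-∈ xs (λ x _ → f≗g x)

∑-++ : ∀ {A : Set} (xs ys : List A) (f : A → ℤ) → ∑ (xs ++ ys) f ≡ ∑ xs f ℤ.+ ∑ ys f
∑-++ []       ys f = sym (ℤₚ.+-identityˡ _)
∑-++ (x ∷ xs) ys f = trans (cong (ℤ._+_ (f x)) (∑-++ xs ys f)) (sym (ℤₚ.+-assoc (f x) _ _))

∑-0 : ∀ {A : Set} (xs : List A) → ∑[ x ∈ xs ] 0ℤ ≡ 0ℤ
∑-0 []       = refl
∑-0 (x ∷ xs) = trans (ℤₚ.+-identityˡ _) (∑-0 xs)

∑-+ : ∀ {A : Set} (xs : List A) (f g : A → ℤ) → ∑[ x ∈ xs ] (f x ℤ.+ g x) ≡ ∑ xs f ℤ.+ ∑ xs g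
∑-+ []       f g = refl
∑-+ (x ∷ xs) f g = trans (cong (ℤ._+_ (f x ℤ.+ g x)) (∑-+ xs f g)) (ℤ+.interchange (f x) (g x) _ _)

∑-neg : ∀ {A : Set} (xs : List A) (f : A → ℤ) → ∑[ x ∈ xs ] ℤ.- f x ≡ ℤ.- ∑ xs f
∑-neg []       f = refl
∑-neg (x ∷ xs) f = trans (cong (ℤ._+_ (ℤ.- f x)) (∑-neg xs f)) (sym (ℤₚ.neg-distrib-+ (f x) (∑ xs f)))

∑-*ˡ : ∀ {A : Set} (xs : List A) (k : ℤ) (f : A → ℤ) → ∑[ x ∈ xs ] (k ℤ.* f x) ≡ k ℤ.* ∑ xs f
∑-*ˡ []       k f = sym (ℤₚ.*-zeroʳ k)
∑-*ˡ (x ∷ xs) k f = trans (cong (ℤ._+_ (k ℤ.* f x)) (∑-*ˡ xs k f)) (sym (ℤₚ.*-distribˡ-+ k (f x) _))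

∑-filter : ∀ {A : Set} {P : A → Set} (P? : ∀ x → Dec (P x)) (xs : List A) (f : A → ℤ) →
           ∑ (filter P? xs) f ≡ ∑[ x ∈ xs ] (if does (P? x) then f x else 0ℤ)
∑-filter P? []       f = refl
∑-filter P? (x ∷ xs) f with does (P? x)
... | true  = cong (ℤ._+_ (f x)) (∑-filter P? xs f)
... | false = trans (∑-filter P? xs f) (sym (ℤₚ.+-identityˡ _))

∑-*ʳ : ∀ {A : Set} (xs : List A) (k : ℤ) (f : A → ℤ) → ∑[ x ∈ xs ] (f x ℤ.* k) ≡ ∑ xs f ℤ.* k
∑-*ʳ xs k f = trans (∑-cong xs (λ x → ℤₚ.*-comm (f x) k)) (trans (∑-*ˡ xs k f) (ℤₚ.*-comm k _))

∑-upTo-suc : ∀ n (f : ℕ → ℤ) → ∑ (upTo (suc n)) f ≡ ∑ (upTo n) f ℤ.+ f n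
∑-upTo-suc n f = trans (cong (λ xs → ∑ xs f) (sym (upTo-∷ʳ n)))
                       (trans (∑-++ (upTo n) [ n ] f) (cong (ℤ._+_ (∑ (upTo n) f)) (ℤₚ.+-identityʳ (f n))))

∑-↭ : ∀ {A : Set} {xs ys : List A} (f : A → ℤ) → xs ↭ ys → ∑ xs f ≡ ∑ ys f
∑-↭ f ↭.refl         = refl
∑-↭ f (↭.prep x p)   = cong (ℤ._+_ (f x)) (∑-↭ f p)
∑-↭ f (↭.swap x y p) = trans (cong (λ s → f x ℤ.+ (f y ℤ.+ s)) (∑-↭ f p)) (ℤ+.x∙yz≈y∙xz (f x) (f y) _)
∑-↭ f (↭.trans p q)  = trans (∑-↭ f p) (∑-↭ f q)

∑-map : ∀ {A B : Set} (g : A → B) (xs : List A) (f : B → ℤ) → ∑ (map g xs) f ≡ ∑ xs (f ∘ g)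
∑-map g xs f = cong sumℤ (sym (map-∘ xs))

∑-concatMap : ∀ {A B : Set} (g : A → List B) (xs : List A) (f : B → ℤ) → ∑ (concatMap g xs) f ≡ ∑[ x ∈ xs ] ∑ (g x) f
∑-concatMap g []       f = refl
∑-concatMap g (x ∷ xs) f = trans (∑-++ (g x) _ f) (cong (ℤ._+_ (∑ (g x) f)) (∑-concatMap g xs f))

∑-swap : ∀ {A B : Set} (xs : List A) (ys : List B) (F : A → B → ℤ) →
         ∑[ x ∈ xs ] ∑[ y ∈ ys ] F x y ≡ ∑[ y ∈ ys ] ∑[ x ∈ xs ] F x y
∑-swap []       ys F = sym (∑-0 ys)
∑-swap (x ∷ xs) ys F = trans (cong (ℤ._+_ (∑ ys (F x))) (∑-swap xs ys F)) (sym (∑-+ ys (F x) _))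

∑-*-∑ : ∀ {A B : Set} (xs : List A) (ys : List B) (f : A → ℤ) (g : B → ℤ) →
        ∑ xs f ℤ.* ∑ ys g ≡ ∑[ x ∈ xs ] ∑[ y ∈ ys ] f x ℤ.* g y
∑-*-∑ xs ys f g = trans (sym (∑-*ʳ xs (∑ ys g) f)) (∑-cong xs (λ x → sym (∑-*ˡ ys (f x) g)))

-- Bag equality of duplicate-free lists only needs equality of their element sets.
∑-bijection : ∀ {A B : Set} (h : A → B) → Injective _≡_ _≡_ h → ∀ {xs ys} → Unique xs → Unique ys →
              (∀ {x} → x ∈ xs → h x ∈ ys) → (∀ {y} → y ∈ ys → ∃[ x ] x ∈ xs × y ≡ h x) →
              (f : B → ℤ) → ∑ ys f ≡ ∑ xs (f ∘ h)
∑-bijection h h-inj {xs} {ys} xs! ys! into onto f =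
  trans (sym (∑-↭ f (∼bag⇒↭ (unique∧set⇒bag (Unique.map⁺ h-inj xs!) ys! (mk⇔ to from)))))
        (∑-map h xs f)
  where
  to : ∀ {y} → y ∈ map h xs → y ∈ ys
  to y∈ with _ , x∈ , refl ← ∈-map⁻ h y∈ = into x∈
  from : ∀ {y} → y ∈ ys → y ∈ map h xs
  from y∈ with _ , x∈ , refl ← onto y∈ = ∈-map⁺ h x∈

fromT : ∀ {A : Set} {b} → Reflects A b → T b → A
fromT (ofʸ a) _ = a

toT : ∀ {A : Set} {b} → Reflects A b → A → T b
toT (ofʸ _)  _ = _
toT (ofⁿ ¬a) a = ¬a a

≡ᵇ-reflects : ∀ a b → Reflects (a ≡ b) (a ≡ᵇ b)
≡ᵇ-reflects a b = fromEquivalence (ℕₚ.≡ᵇ⇒≡ a b) (ℕₚ.≡⇒≡ᵇ a b)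

-- deg e i is the exponent of x_{i+1}: indices start at 0, as in Defs.
deg : List ℕ → ℕ → ℕ
deg []       i       = 0
deg (x ∷ xs) zero    = x
deg (x ∷ xs) (suc i) = deg xs i

infix 4 _≈ᵐ_
_≈ᵐ_ : List ℕ → List ℕ → Set
a ≈ᵐ b = ∀ i → deg a i ≡ deg b i

tl : List ℕ → List ℕ
tl []       = []
tl (_ ∷ xs) = xs

head0≡deg0 : ∀ e → head0 e ≡ deg e 0
head0≡deg0 []      = refl
head0≡deg0 (_ ∷ _) = refl

deg-tl : ∀ e i → deg (tl e) i ≡ deg e (suc i)
deg-tl []      i = refl
deg-tl (_ ∷ _) i = refl

deg-addV : ∀ a b i → deg (addV a b) i ≡ deg a i + deg b i
deg-addV []      b       i       = refl
deg-addV (x ∷ a) []      i       = sym (ℕₚ.+-identityʳ _)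
deg-addV (x ∷ a) (y ∷ b) zero    = refl
deg-addV (x ∷ a) (y ∷ b) (suc i) = deg-addV a b i

addV-comm : ∀ a b → addV a b ≈ᵐ addV b a
addV-comm a b i = trans (deg-addV a b i) (trans (ℕₚ.+-comm (deg a i) (deg b i)) (sym (deg-addV b a i)))

deg-norm : ∀ a i → deg (norm a) i ≡ deg a i
deg-norm []       i = refl
deg-norm (x ∷ xs) i with norm xs | deg-norm xs
deg-norm (zero  ∷ xs) zero    | []    | _  = refl
deg-norm (suc x ∷ xs) zero    | []    | _  = refl
deg-norm (zero  ∷ xs) (suc i) | []    | ih = ih i
deg-norm (suc x ∷ xs) (suc i) | []    | ih = ih i
deg-norm (x ∷ xs)     zero    | _ ∷ _ | _  = refl
deg-norm (x ∷ xs)     (suc i) | _ ∷ _ | ih = ih i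

normCons : ℕ → List ℕ → List ℕ
normCons x []       = if x ≡ᵇ 0 then [] else [ x ]
normCons x (y ∷ ys) = x ∷ y ∷ ys

norm-∷ : ∀ x xs → norm (x ∷ xs) ≡ normCons x (norm xs)
norm-∷ x xs with norm xs
... | []    = refl
... | _ ∷ _ = refl

≈ᵐ⇒norm≡ : ∀ a b → a ≈ᵐ b → norm a ≡ norm b
≈ᵐ⇒norm≡ []       []       a≈b = refl
≈ᵐ⇒norm≡ []       (y ∷ ys) a≈b =
  trans (cong₂ normCons (a≈b 0) (≈ᵐ⇒norm≡ [] ys (a≈b ∘ suc))) (sym (norm-∷ y ys))
≈ᵐ⇒norm≡ (x ∷ xs) []       a≈b =
  trans (norm-∷ x xs) (cong₂ normCons (a≈b 0) (≈ᵐ⇒norm≡ xs [] (a≈b ∘ suc)))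
≈ᵐ⇒norm≡ (x ∷ xs) (y ∷ ys) a≈b =
  trans (norm-∷ x xs) (trans (cong₂ normCons (a≈b 0) (≈ᵐ⇒norm≡ xs ys (a≈b ∘ suc))) (sym (norm-∷ y ys)))

eqL-refl : ∀ u → T (eqL u u)
eqL-refl []      = _
eqL-refl (x ∷ u) = Equivalence.from T-∧ (ℕₚ.≡⇒≡ᵇ x x refl , eqL-refl u)

eqL-sound : ∀ u v → T (eqL u v) → u ≡ v
eqL-sound []      []      _ = refl
eqL-sound (x ∷ u) (y ∷ v) t with x≡ᵇy , u≡v ← Equivalence.to T-∧ t =
  cong₂ _∷_ (ℕₚ.≡ᵇ⇒≡ x y x≡ᵇy) (eqL-sound u v u≡v)

sameMon-reflects : ∀ a b → Reflects (a ≈ᵐ b) (sameMon a b)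
sameMon-reflects a b = fromEquivalence sound complete
  where
  sound : T (sameMon a b) → a ≈ᵐ b
  sound t i = trans (sym (deg-norm a i)) (trans (cong (λ z → deg z i) (eqL-sound (norm a) (norm b) t)) (deg-norm b i))
  complete : a ≈ᵐ b → T (sameMon a b)
  complete a≈b = subst (λ z → T (eqL (norm a) z)) (≈ᵐ⇒norm≡ a b a≈b) (eqL-refl (norm a))

mono : List ℕ → Series
mono = monoS 1ℤ

mono-≉ : ∀ {e m} → ¬ e ≈ᵐ m → mono e m ≡ 0ℤ
mono-≉ {e} {m} e≉m with sameMon e m | sameMon-reflects e m
... | true  | ofʸ e≈m = ⊥-elim (e≉m e≈m)
... | false | _        = refl

mono-resp-≈ᵐ : ∀ {e e′} m → e ≈ᵐ e′ → mono e m ≡ mono e′ m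
mono-resp-≈ᵐ {e} {e′} m e≈e′ = cong (λ z → if eqL z (norm m) then 1ℤ else 0ℤ) (≈ᵐ⇒norm≡ e e′ e≈e′)

mono-addV-comm : ∀ a b m → mono (addV a b) m ≡ mono (addV b a) m
mono-addV-comm a b m = mono-resp-≈ᵐ {addV a b} {addV b a} m (addV-comm a b)

δ : ℕ → ℕ → ℤ
δ a b = if a ≡ᵇ b then 1ℤ else 0ℤ

δ-refl : ∀ a → δ a a ≡ 1ℤ
δ-refl a with a ≡ᵇ a | ≡ᵇ-reflects a a
... | true  | _        = refl
... | false | ofⁿ a≢a = ⊥-elim (a≢a refl)

δ-≢ : ∀ {a b} → ¬ a ≡ b → δ a b ≡ 0ℤ
δ-≢ {a} {b} a≢b with a ≡ᵇ b | ≡ᵇ-reflects a b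
... | true  | ofʸ a≡b = ⊥-elim (a≢b a≡b)
... | false | _        = refl

δ-resp-⇔ : ∀ {a b c d} → a ≡ b ⇔ c ≡ d → δ a b ≡ δ c d
δ-resp-⇔ {a} {b} {c} {d} a≡b⇔c≡d with a ≡ᵇ b | ≡ᵇ-reflects a b | c ≡ᵇ d | ≡ᵇ-reflects c d
... | true  | _         | true  | _         = refl
... | false | _         | false | _         = refl
... | true  | ofʸ a≡b  | false | ofⁿ c≢d  = ⊥-elim (c≢d (Equivalence.to a≡b⇔c≡d a≡b))
... | false | ofⁿ a≢b  | true  | ofʸ c≡d  = ⊥-elim (a≢b (Equivalence.from a≡b⇔c≡d c≡d))

mono-∷ : ∀ e b d → mono e (b ∷ d) ≡ δ (head0 e) b ℤ.* mono (tl e) d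
mono-∷ e b d
  with sameMon e (b ∷ d) | sameMon-reflects e (b ∷ d) | head0 e ≡ᵇ b | ≡ᵇ-reflects (head0 e) b
     | sameMon (tl e) d | sameMon-reflects (tl e) d
... | true  | _        | true  | _            | true  | _         = refl
... | true  | ofʸ e≈  | false | ofⁿ e₀≢b    | _     | _         = ⊥-elim (e₀≢b (trans (head0≡deg0 e) (e≈ 0)))
... | true  | ofʸ e≈  | true  | _            | false | ofⁿ tl≉  = ⊥-elim (tl≉ (λ i → trans (deg-tl e i) (e≈ (suc i))))
... | false | ofⁿ e≉ | true  | ofʸ e₀≡b    | true  | ofʸ tl≈  =
  ⊥-elim (e≉ λ { zero → trans (sym (head0≡deg0 e)) e₀≡b ; (suc i) → trans (sym (deg-tl e i)) (tl≈ i) })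
... | false | _        | true  | _            | false | _         = refl
... | false | _        | false | _            | _     | _         = refl

mono-[] : ∀ e w → mono e [] ℤ.* mono w [] ≡ mono (addV e w) []
mono-[] e w
  with sameMon e [] | sameMon-reflects e [] | sameMon w [] | sameMon-reflects w []
     | sameMon (addV e w) [] | sameMon-reflects (addV e w) []
... | true  | _        | true  | _        | true  | _         = refl
... | true  | ofʸ e≈  | true  | ofʸ w≈  | false | ofⁿ ew≉  =
  ⊥-elim (ew≉ (λ i → trans (deg-addV e w i) (cong₂ _+_ (e≈ i) (w≈ i))))
... | false | ofⁿ e≉ | _     | _        | true  | ofʸ ew≈  =
  ⊥-elim (e≉ (λ i → ℕₚ.m+n≡0⇒m≡0 (deg e i) (trans (sym (deg-addV e w i)) (ew≈ i))))
... | true  | _        | false | ofⁿ w≉ | true  | ofʸ ew≈  =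
  ⊥-elim (w≉ (λ i → ℕₚ.m+n≡0⇒n≡0 (deg e i) (trans (sym (deg-addV e w i)) (ew≈ i))))
... | true  | _        | false | _        | false | _         = refl
... | false | _        | _     | _        | false | _         = refl

∑-δ-≥ : ∀ {n x} (F : ℕ → ℤ) → n ≤ x → ∑[ b ∈ upTo n ] δ x b ℤ.* F b ≡ 0ℤ
∑-δ-≥ {n} {x} F n≤x = trans (∑-cong-∈ (upTo n) vanish) (∑-0 (upTo n))
  where
  vanish : ∀ b → b ∈ upTo n → δ x b ℤ.* F b ≡ 0ℤ
  vanish b b∈ = cong (λ z → z ℤ.* F b)
                     (δ-≢ (λ x≡b → ℕₚ.<⇒≢ (ℕₚ.<-≤-trans (∈-upTo⁻ b∈) n≤x) (sym x≡b)))

∑-δ-< : ∀ {n x} (F : ℕ → ℤ) → x < n → ∑[ b ∈ upTo n ] δ x b ℤ.* F b ≡ F x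
∑-δ-< {suc n} {x} F x<1+n with ℕₚ.m<1+n⇒m<n∨m≡n x<1+n
... | inj₁ x<n  = begin
  ∑[ b ∈ upTo (suc n) ] δ x b ℤ.* F b                ≡⟨ ∑-upTo-suc n _ ⟩
  (∑[ b ∈ upTo n ] δ x b ℤ.* F b) ℤ.+ δ x n ℤ.* F n ≡⟨ cong₂ ℤ._+_ (∑-δ-< F x<n)
                                                                  (cong (λ z → z ℤ.* F n) (δ-≢ (ℕₚ.<⇒≢ x<n))) ⟩
  F x ℤ.+ 0ℤ                                       ≡⟨ ℤₚ.+-identityʳ (F x) ⟩
  F x                                              ∎
  where open ≡-Reasoning
... | inj₂ refl = begin
  ∑[ b ∈ upTo (suc n) ] δ n b ℤ.* F b                ≡⟨ ∑-upTo-suc n _ ⟩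
  (∑[ b ∈ upTo n ] δ n b ℤ.* F b) ℤ.+ δ n n ℤ.* F n ≡⟨ cong₂ ℤ._+_ (∑-δ-≥ {n} F ℕₚ.≤-refl)
                                                                  (cong (λ z → z ℤ.* F n) (δ-refl n)) ⟩
  0ℤ ℤ.+ 1ℤ ℤ.* F n                                ≡⟨ trans (ℤₚ.+-identityˡ _) (ℤₚ.*-identityˡ (F n)) ⟩
  F n                                              ∎
  where open ≡-Reasoning

∑-antidiagonal-δ : ∀ a x y (R : ℤ) → ∑[ b ∈ upTo (suc a) ] δ x b ℤ.* (δ y (a ∸ b) ℤ.* R) ≡ δ (x + y) a ℤ.* R
∑-antidiagonal-δ a x y R with x ℕ.≤? a
... | yes x≤a = trans (∑-δ-< (λ b → δ y (a ∸ b) ℤ.* R) (s≤s x≤a)) (cong (λ z → z ℤ.* R) (δ-resp-⇔ (mk⇔ to from)))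
  where
  to : y ≡ a ∸ x → x + y ≡ a
  to y≡a∸x = trans (cong (x +_) y≡a∸x) (ℕₚ.m+[n∸m]≡n x≤a)
  from : x + y ≡ a → y ≡ a ∸ x
  from x+y≡a = trans (sym (ℕₚ.m+n∸m≡n x y)) (cong (_∸ x) x+y≡a)
... | no x≰a = trans (∑-δ-≥ (λ b → δ y (a ∸ b) ℤ.* R) (ℕₚ.≰⇒> x≰a))
                     (cong (λ z → z ℤ.* R) (sym (δ-≢ (λ x+y≡a → x≰a (subst (x ≤_) x+y≡a (ℕₚ.m≤m+n x y))))))

addV-identityʳ : ∀ a → addV a [] ≡ a
addV-identityʳ []      = refl
addV-identityʳ (_ ∷ _) = refl

head0-addV : ∀ a b → head0 (addV a b) ≡ head0 a + head0 b
head0-addV []      b       = refl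
head0-addV (x ∷ a) []      = sym (ℕₚ.+-identityʳ x)
head0-addV (x ∷ a) (y ∷ b) = refl

tl-addV : ∀ a b → tl (addV a b) ≡ addV (tl a) (tl b)
tl-addV []      b       = refl
tl-addV (x ∷ a) []      = sym (addV-identityʳ a)
tl-addV (x ∷ a) (y ∷ b) = refl

mono-⊛ : ∀ e w → mono e ⊛ mono w ≋ mono (addV e w)
mono-⊛ e w []      = trans (ℤₚ.+-identityʳ _) (mono-[] e w)
mono-⊛ e w (a ∷ m) = begin
  ∑[ d ∈ divisors (a ∷ m) ] mono e d ℤ.* mono w (zipWith _∸_ (a ∷ m) d)
    ≡⟨ ∑-concatMap (λ b → map (b ∷_) (divisors m)) (upTo (suc a)) _ ⟩
  ∑[ b ∈ upTo (suc a) ] ∑ (map (b ∷_) (divisors m)) (λ d → mono e d ℤ.* mono w (zipWith _∸_ (a ∷ m) d))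
    ≡⟨ ∑-cong (upTo (suc a)) (λ b → trans (∑-map (b ∷_) (divisors m) _) (column b)) ⟩
  ∑[ b ∈ upTo (suc a) ] δ (head0 e) b ℤ.* (δ (head0 w) (a ∸ b) ℤ.* mono (addV (tl e) (tl w)) m)
    ≡⟨ ∑-antidiagonal-δ a (head0 e) (head0 w) _ ⟩
  δ (head0 e + head0 w) a ℤ.* mono (addV (tl e) (tl w)) m
    ≡⟨ sym (cong₂ (λ x v → δ x a ℤ.* mono v m) (head0-addV e w) (tl-addV e w)) ⟩
  δ (head0 (addV e w)) a ℤ.* mono (tl (addV e w)) m
    ≡⟨ sym (mono-∷ (addV e w) a m) ⟩
  mono (addV e w) (a ∷ m) ∎
  where
  open ≡-Reasoning
  module ℤ* = CommSemigroupProperties ℤₚ.*-commutativeSemigroup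
  column : ∀ b → ∑[ d ∈ divisors m ] mono e (b ∷ d) ℤ.* mono w ((a ∸ b) ∷ zipWith _∸_ m d)
                 ≡ δ (head0 e) b ℤ.* (δ (head0 w) (a ∸ b) ℤ.* mono (addV (tl e) (tl w)) m)
  column b = begin
    ∑[ d ∈ divisors m ] mono e (b ∷ d) ℤ.* mono w ((a ∸ b) ∷ zipWith _∸_ m d)
      ≡⟨ ∑-cong (divisors m) (λ d → trans (cong₂ ℤ._*_ (mono-∷ e b d) (mono-∷ w (a ∸ b) (zipWith _∸_ m d)))
                                          (ℤ*.interchange (δ (head0 e) b) (mono (tl e) d) _ _)) ⟩
    ∑[ d ∈ divisors m ] (δ (head0 e) b ℤ.* δ (head0 w) (a ∸ b)) ℤ.* (mono (tl e) d ℤ.* mono (tl w) (zipWith _∸_ m d))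
      ≡⟨ ∑-*ˡ (divisors m) (δ (head0 e) b ℤ.* δ (head0 w) (a ∸ b))
              (λ d → mono (tl e) d ℤ.* mono (tl w) (zipWith _∸_ m d)) ⟩
    (δ (head0 e) b ℤ.* δ (head0 w) (a ∸ b)) ℤ.* (mono (tl e) ⊛ mono (tl w)) m
      ≡⟨ cong (ℤ._*_ (δ (head0 e) b ℤ.* δ (head0 w) (a ∸ b))) (mono-⊛ (tl e) (tl w) m) ⟩
    (δ (head0 e) b ℤ.* δ (head0 w) (a ∸ b)) ℤ.* mono (addV (tl e) (tl w)) m
      ≡⟨ ℤₚ.*-assoc (δ (head0 e) b) _ _ ⟩
    δ (head0 e) b ℤ.* (δ (head0 w) (a ∸ b) ℤ.* mono (addV (tl e) (tl w)) m) ∎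

⊛-distribˡ-⊕ : ∀ f g h → f ⊛ (g ⊕ h) ≋ f ⊛ g ⊕ f ⊛ h
⊛-distribˡ-⊕ f g h m =
  trans (∑-cong (divisors m) (λ d → ℤₚ.*-distribˡ-+ (f d) _ _)) (∑-+ (divisors m) _ _)

⊛-distribˡ-⊝ : ∀ f g h → f ⊛ (g ⊝ h) ≋ f ⊛ g ⊝ f ⊛ h
⊛-distribˡ-⊝ f g h m = trans (⊛-distribˡ-⊕ f g (⊖ h) m) (cong (ℤ._+_ ((f ⊛ g) m)) (trans
  (∑-cong (divisors m) (λ d → sym (ℤₚ.neg-distribʳ-* (f d) (h (zipWith _∸_ m d))))) (∑-neg (divisors m) _)))

⊛-congˡ : ∀ f {g g′} → g ≋ g′ → f ⊛ g ≋ f ⊛ g′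
⊛-congˡ f g≋g′ m = ∑-cong (divisors m) (λ d → cong (ℤ._*_ (f d)) (g≋g′ (zipWith _∸_ m d)))

⊛-congʳ : ∀ {f f′} g → f ≋ f′ → f ⊛ g ≋ f′ ⊛ g
⊛-congʳ g f≋f′ m = ∑-cong (divisors m) (λ d → cong (λ z → z ℤ.* g (zipWith _∸_ m d)) (f≋f′ d))

head0-zipWith-∸ : ∀ m d → head0 (zipWith _∸_ m d) ≤ head0 m
head0-zipWith-∸ []      d       = z≤n
head0-zipWith-∸ (a ∷ m) []      = z≤n
head0-zipWith-∸ (a ∷ m) (b ∷ d) = ℕₚ.m∸n≤m a b

head0-divisor : ∀ m d → d ∈ divisors m → head0 d ≤ head0 m
head0-divisor []      d (here refl) = z≤n
head0-divisor (a ∷ m) d d∈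
  with b , b∈ , d∈′ ← find (∈-concatMap⁻ (λ b → map (b ∷_) (divisors m)) {xs = upTo (suc a)} d∈)
  with _ , _ , refl ← ∈-map⁻ (b ∷_) d∈′ = ℕₚ.≤-pred (∈-upTo⁻ b∈)

-- f is the generating function of a family of monomials with finitely many members of each
-- x₁-degree; family H contains all members needed for the coefficients of x₁-degree at most H.
record GeneratingFamily (f : Series) : Set₁ where
  field
    Index  : Set
    family : ℕ → List Index
    weight : Index → List ℕ
    coeff  : ∀ H m → head0 m ≤ H → f m ≡ ∑[ i ∈ family H ] mono (weight i) m

open GeneratingFamily

monoFamily : ∀ e → GeneratingFamily (mono e)
monoFamily e = record
  { Index = ⊤ ; family = λ _ → [ tt ] ; weight = λ _ → e ; coeff = λ _ m _ → sym (ℤₚ.+-identityʳ (mono e m)) }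

⊛-coeff : ∀ {f g} (F : GeneratingFamily f) (G : GeneratingFamily g) H m → head0 m ≤ H →
          (f ⊛ g) m ≡ ∑[ i ∈ family F H ] ∑[ j ∈ family G H ] mono (addV (weight F i) (weight G j)) m
⊛-coeff {f} {g} F G H m m≤H = begin
  ∑[ d ∈ divisors m ] f d ℤ.* g (m ∸ᵐ d)
    ≡⟨ ∑-cong-∈ (divisors m) (λ d d∈ → cong₂ ℤ._*_ (coeff F H d (ℕₚ.≤-trans (head0-divisor m d d∈) m≤H))
                                                    (coeff G H (m ∸ᵐ d) (ℕₚ.≤-trans (head0-zipWith-∸ m d) m≤H))) ⟩
  ∑[ d ∈ divisors m ] (∑[ i ∈ Fs ] mono (weight F i) d) ℤ.* (∑[ j ∈ Gs ] mono (weight G j) (m ∸ᵐ d))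
    ≡⟨ ∑-cong (divisors m) (λ d → ∑-*-∑ Fs Gs _ _) ⟩
  ∑[ d ∈ divisors m ] ∑[ i ∈ Fs ] ∑[ j ∈ Gs ] mono (weight F i) d ℤ.* mono (weight G j) (m ∸ᵐ d)
    ≡⟨ ∑-swap (divisors m) Fs _ ⟩
  ∑[ i ∈ Fs ] ∑[ d ∈ divisors m ] ∑[ j ∈ Gs ] mono (weight F i) d ℤ.* mono (weight G j) (m ∸ᵐ d)
    ≡⟨ ∑-cong Fs (λ i → ∑-swap (divisors m) Gs _) ⟩
  ∑[ i ∈ Fs ] ∑[ j ∈ Gs ] (mono (weight F i) ⊛ mono (weight G j)) m
    ≡⟨ ∑-cong Fs (λ i → ∑-cong Gs (λ j → mono-⊛ (weight F i) (weight G j) m)) ⟩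
  ∑[ i ∈ Fs ] ∑[ j ∈ Gs ] mono (addV (weight F i) (weight G j)) m ∎
  where
  open ≡-Reasoning
  Fs = family F H
  Gs = family G H
  _∸ᵐ_ : List ℕ → List ℕ → List ℕ
  _∸ᵐ_ = zipWith _∸_

⊛-mono-coeff : ∀ {f} (F : GeneratingFamily f) e H m → head0 m ≤ H →
               (f ⊛ mono e) m ≡ ∑[ i ∈ family F H ] mono (addV (weight F i) e) m
⊛-mono-coeff F e H m m≤H = trans (⊛-coeff F (monoFamily e) H m m≤H) (∑-cong (family F H) (λ i → ℤₚ.+-identityʳ _))

mono-⊛ᶠ : ∀ e {g} → GeneratingFamily g → GeneratingFamily (mono e ⊛ g)
mono-⊛ᶠ e G = record
  { Index  = Index G
  ; family = family G
  ; weight = addV e ∘ weight G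
  ; coeff  = λ H m m≤H → trans (⊛-coeff (monoFamily e) G H m m≤H) (ℤₚ.+-identityʳ _)
  }

data Tree : Set where
  leaf : Tree
  node : Tree → Tree → Tree

size : Tree → ℕ
size leaf       = 0
size (node l r) = suc (size l + size r)

-- A 132-avoider with maximum n is π′ n π″ where every entry of π′ exceeds every entry of π″.
flatten : Tree → List ℕ
flatten leaf       = []
flatten (node l r) = map (size r +_) (flatten l) ++ (size l + size r) ∷ flatten r

graft : Tree → Tree → Tree
graft leaf         x = x
graft (node g₁ g₂) x = node g₁ (graft g₂ x)

inv : Tree → Tree
inv leaf       = leaf
inv (node l r) = graft (inv r) (node (inv l) leaf)

node-injective : ∀ {a b c d} → node a b ≡ node c d → a ≡ c × b ≡ d
node-injective refl = refl , refl

size-graft : ∀ g x → size (graft g x) ≡ size g + size x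
size-graft leaf         x = refl
size-graft (node g₁ g₂) x = cong suc (trans (cong (size g₁ +_) (size-graft g₂ x)) (sym (ℕₚ.+-assoc (size g₁) _ _)))

size-inv : ∀ t → size (inv t) ≡ size t
size-inv leaf       = refl
size-inv (node l r) = begin
  size (graft (inv r) (node (inv l) leaf)) ≡⟨ size-graft (inv r) _ ⟩
  size (inv r) + suc (size (inv l) + 0)    ≡⟨ cong₂ (λ a b → a + suc (b + 0)) (size-inv r) (size-inv l) ⟩
  size r + suc (size l + 0)                ≡⟨ ℕₚ.+-suc (size r) _ ⟩
  suc (size r + (size l + 0))              ≡⟨ cong (λ b → suc (size r + b)) (ℕₚ.+-identityʳ (size l)) ⟩
  suc (size r + size l)                    ≡⟨ cong suc (ℕₚ.+-comm (size r) (size l)) ⟩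
  suc (size l + size r)                    ∎
  where open ≡-Reasoning

graft-identityʳ : ∀ t → graft t leaf ≡ t
graft-identityʳ leaf       = refl
graft-identityʳ (node l r) = cong (node l) (graft-identityʳ r)

graft-assoc : ∀ a b c → graft (graft a b) c ≡ graft a (graft b c)
graft-assoc leaf         b c = refl
graft-assoc (node a₁ a₂) b c = cong (node a₁) (graft-assoc a₂ b c)

inv-graft : ∀ g x → inv (graft g x) ≡ graft (inv x) (inv g)
inv-graft leaf         x = sym (graft-identityʳ (inv x))
inv-graft (node g₁ g₂) x = trans (cong (λ t → graft t (node (inv g₁) leaf)) (inv-graft g₂ x))
                                 (graft-assoc (inv x) (inv g₂) (node (inv g₁) leaf))

inv-involutive : ∀ t → inv (inv t) ≡ t
inv-involutive leaf       = refl
inv-involutive (node l r) = begin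
  inv (graft (inv r) (node (inv l) leaf))      ≡⟨ inv-graft (inv r) _ ⟩
  graft (node (inv (inv l)) leaf) (inv (inv r)) ≡⟨ cong₂ (λ a b → node a b) (inv-involutive l) (inv-involutive r) ⟩
  node l r                                      ∎
  where open ≡-Reasoning

graft-node≢leaf : ∀ g a b → ¬ graft g (node a b) ≡ leaf
graft-node≢leaf leaf       a b ()
graft-node≢leaf (node _ _) a b ()

map-+-+ : ∀ a b xs → map (a +_) (map (b +_) xs) ≡ map ((a + b) +_) xs
map-+-+ a b xs = trans (sym (map-∘ xs)) (map-cong (λ v → sym (ℕₚ.+-assoc a b v)) xs)

map-++-∷ : ∀ (f : ℕ → ℕ) xs n ys zs → map f (xs ++ n ∷ ys) ++ zs ≡ map f xs ++ f n ∷ (map f ys ++ zs)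
map-++-∷ f xs n ys zs = trans (cong (_++ zs) (map-++ f xs (n ∷ ys))) (++-assoc (map f xs) (f n ∷ map f ys) zs)

flatten-graft : ∀ g x → flatten (graft g x) ≡ map (size x +_) (flatten g) ++ flatten x
flatten-graft leaf         x = refl
flatten-graft (node g₁ g₂) x = begin
  map (size (graft g₂ x) +_) (flatten g₁) ++ (size g₁ + size (graft g₂ x)) ∷ flatten (graft g₂ x)
    ≡⟨ cong₂ (λ s fl → map (s +_) (flatten g₁) ++ (size g₁ + s) ∷ fl) (size-graft g₂ x) (flatten-graft g₂ x) ⟩
  map ((size g₂ + size x) +_) (flatten g₁) ++ (size g₁ + (size g₂ + size x)) ∷ (map (size x +_) (flatten g₂) ++ flatten x)
    ≡⟨ cong₂ (λ ys n → ys ++ n ∷ (map (size x +_) (flatten g₂) ++ flatten x))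
             (trans (cong (λ s → map (s +_) (flatten g₁)) (ℕₚ.+-comm (size g₂) (size x)))
                    (sym (map-+-+ (size x) (size g₂) (flatten g₁))))
             (trans (sym (ℕₚ.+-assoc (size g₁) (size g₂) (size x))) (ℕₚ.+-comm (size g₁ + size g₂) (size x))) ⟩
  map (size x +_) (map (size g₂ +_) (flatten g₁)) ++ (size x + (size g₁ + size g₂)) ∷ (map (size x +_) (flatten g₂) ++ flatten x)
    ≡⟨ sym (map-++-∷ (size x +_) (map (size g₂ +_) (flatten g₁)) (size g₁ + size g₂) (flatten g₂) (flatten x)) ⟩
  map (size x +_) (flatten (node g₁ g₂)) ++ flatten x ∎
  where open ≡-Reasoning

length-flatten : ∀ t → length (flatten t) ≡ size t
length-flatten leaf       = refl
length-flatten (node l r) = begin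
  length (map (size r +_) (flatten l) ++ (size l + size r) ∷ flatten r) ≡⟨ length-++ (map (size r +_) (flatten l)) ⟩
  length (map (size r +_) (flatten l)) + suc (length (flatten r))     ≡⟨ cong₂ (λ a b → a + suc b)
                                                                           (trans (length-map _ (flatten l)) (length-flatten l))
                                                                           (length-flatten r) ⟩
  size l + suc (size r)                                               ≡⟨ ℕₚ.+-suc (size l) (size r) ⟩
  suc (size l + size r)                                               ∎
  where open ≡-Reasoning

flatten-bounded : ∀ t → All (_< size t) (flatten t)
left-block-bounded : ∀ l r → All (_< size l + size r) (map (size r +_) (flatten l))
left-block-bounded l r =
  All.map⁺ (All.map (λ {v} v<l → subst (size r + v <_) (ℕₚ.+-comm (size r) (size l)) (ℕₚ.+-monoʳ-< (size r) v<l))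
                    (flatten-bounded l))

left-block-above : ∀ l r → All (size r ≤_) (map (size r +_) (flatten l))
left-block-above l r = All.map⁺ (All.universal (ℕₚ.m≤m+n (size r)) (flatten l))

flatten-bounded leaf       = []
flatten-bounded (node l r) = All.++⁺ (All.map ℕₚ.m<n⇒m<1+n (left-block-bounded l r))
  (ℕₚ.n<1+n _ ∷ All.map (λ v<r → ℕₚ.m<n⇒m<1+n (ℕₚ.<-≤-trans v<r (ℕₚ.m≤n+m (size r) (size l))))
                        (flatten-bounded r))

<ᵇ-true : ∀ {m n} → m < n → (m <ᵇ n) ≡ true
<ᵇ-true m<n = Equivalence.to T-≡ (ℕₚ.<⇒<ᵇ m<n)

<ᵇ-false : ∀ {m n} → n ≤ m → (m <ᵇ n) ≡ false
<ᵇ-false {m} {n} n≤m with m <ᵇ n | ℕₚ.<ᵇ-reflects-< m n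
... | true  | ofʸ m<n = ⊥-elim (ℕₚ.≤⇒≯ n≤m m<n)
... | false | _        = refl

<ᵇ-+ˡ : ∀ s v x → (s + v <ᵇ s + x) ≡ (v <ᵇ x)
<ᵇ-+ˡ zero    v x = refl
<ᵇ-+ˡ (suc s) v x = <ᵇ-+ˡ s v x

incAbove-shift : ∀ c s v xs → incAbove c (s + v) (map (s +_) xs) ≡ incAbove c v xs
incAbove-shift zero    s v xs       = refl
incAbove-shift (suc c) s v []       = refl
incAbove-shift (suc c) s v (x ∷ xs) rewrite <ᵇ-+ˡ s v x | incAbove-shift (suc c) s v xs with v <ᵇ x
... | true  = cong (_+ incAbove (suc c) v xs) (incAbove-shift c s x xs)
... | false = refl

pat-shift : ∀ k s xs → pat k (map (s +_) xs) ≡ pat k xs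
pat-shift k s []            = refl
pat-shift k s (a ∷ [])      = refl
pat-shift k s (a ∷ b ∷ xs) =
  cong₂ _+_ (cong₂ (λ c n → if c then n else 0) (<ᵇ-+ˡ s a b) (incAbove-shift (k ∸ 2) s b xs)) (pat-shift k s (b ∷ xs))

incAbove-below : ∀ c v ys → All (_≤ v) ys → incAbove (suc c) v ys ≡ 0
incAbove-below c v []       []         = refl
incAbove-below c v (y ∷ ys) (y≤v ∷ ps) rewrite <ᵇ-false y≤v = incAbove-below c v ys ps

incAbove-++-below : ∀ c v b xs ys → All (_< b) ys → b ≤ v → All (b ≤_) xs → incAbove c v (xs ++ ys) ≡ incAbove c v xs
incAbove-++-below zero    v b xs       ys ys<b b≤v _            = refl
incAbove-++-below (suc c) v b []       ys ys<b b≤v _            =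
  incAbove-below c v ys (All.map (λ y<b → ℕₚ.<⇒≤ (ℕₚ.<-≤-trans y<b b≤v)) ys<b)
incAbove-++-below (suc c) v b (x ∷ xs) ys ys<b b≤v (b≤x ∷ b≤xs)
  rewrite incAbove-++-below (suc c) v b xs ys ys<b b≤v b≤xs with v <ᵇ x
... | true  = cong (_+ incAbove (suc c) v xs) (incAbove-++-below c x b xs ys ys<b b≤x b≤xs)
... | false = refl

pat-++-below : ∀ k b xs ys → All (_< b) ys → All (b ≤_) xs → pat k (xs ++ ys) ≡ pat k xs + pat k ys
pat-++-below k b []            ys       _          _               = refl
pat-++-below k b (x ∷ [])      []       _          _               = refl
pat-++-below k b (x ∷ [])      (y ∷ ys) (y<b ∷ _)  (b≤x ∷ _)
  rewrite <ᵇ-false (ℕₚ.<⇒≤ (ℕₚ.<-≤-trans y<b b≤x)) = refl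
pat-++-below k b (x ∷ x′ ∷ xs) ys       ys<b       (_ ∷ b≤x′ ∷ b≤xs) =
  trans (cong₂ _+_ (cong (λ n → if x <ᵇ x′ then n else 0) (incAbove-++-below (k ∸ 2) x′ b xs ys ys<b b≤x′ b≤xs))
                   (pat-++-below k b (x′ ∷ xs) ys ys<b (b≤x′ ∷ b≤xs)))
        (sym (ℕₚ.+-assoc (if x <ᵇ x′ then incAbove (k ∸ 2) x′ xs else 0) (pat k (x′ ∷ xs)) (pat k ys)))

incAbove-∷ʳ-max : ∀ c v N xs → v < N → All (_< N) xs →
                  incAbove (suc c) v (xs ++ [ N ]) ≡ incAbove (suc c) v xs + incAbove c v xs
incAbove-∷ʳ-max zero    v N []       v<N _ rewrite <ᵇ-true v<N = refl
incAbove-∷ʳ-max (suc c) v N []       v<N _ rewrite <ᵇ-true v<N = refl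
incAbove-∷ʳ-max zero    v N (x ∷ xs) v<N (x<N ∷ xs<N) rewrite incAbove-∷ʳ-max zero v N xs v<N xs<N with v <ᵇ x
... | true  = sym (ℕₚ.+-assoc 1 (incAbove 1 v xs) 1)
... | false = refl
incAbove-∷ʳ-max (suc c) v N (x ∷ xs) v<N (x<N ∷ xs<N) rewrite incAbove-∷ʳ-max (suc c) v N xs v<N xs<N with v <ᵇ x
... | true  rewrite incAbove-∷ʳ-max c x N xs x<N xs<N = ℕ+.interchange (incAbove (suc c) x xs) _ _ _
... | false = refl

nonEmpty : List ℕ → ℕ
nonEmpty []      = 0
nonEmpty (_ ∷ _) = 1

pat₂-∷ʳ-max : ∀ N xs → All (_< N) xs → pat 2 (xs ++ [ N ]) ≡ pat 2 xs + nonEmpty xs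
pat₂-∷ʳ-max N []            _          = refl
pat₂-∷ʳ-max N (x ∷ [])      (x<N ∷ _) rewrite <ᵇ-true x<N = refl
pat₂-∷ʳ-max N (x ∷ x′ ∷ xs) (_ ∷ xs<N) rewrite pat₂-∷ʳ-max N (x′ ∷ xs) xs<N =
  sym (ℕₚ.+-assoc (if x <ᵇ x′ then 1 else 0) (pat 2 (x′ ∷ xs)) 1)

pat-∷ʳ-max : ∀ j N xs → All (_< N) xs → pat (3 + j) (xs ++ [ N ]) ≡ pat (3 + j) xs + pat (2 + j) xs
pat-∷ʳ-max j N []            _                 = refl
pat-∷ʳ-max j N (x ∷ [])      (x<N ∷ _)         rewrite <ᵇ-true x<N = refl
pat-∷ʳ-max j N (x ∷ x′ ∷ xs) (_ ∷ x′<N ∷ xs<N) =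
  trans (cong₂ _+_ first (pat-∷ʳ-max j N (x′ ∷ xs) (x′<N ∷ xs<N))) (ℕ+.interchange (lead (suc j)) (lead j) _ _)
  where
  lead : ℕ → ℕ
  lead c = if x <ᵇ x′ then incAbove c x′ xs else 0
  first : (if x <ᵇ x′ then incAbove (suc j) x′ (xs ++ [ N ]) else 0) ≡ lead (suc j) + lead j
  first rewrite incAbove-∷ʳ-max j x′ N xs x′<N xs<N with x <ᵇ x′
  ... | true  = refl
  ... | false = refl

nonLeaf : Tree → ℕ
nonLeaf leaf       = 0
nonLeaf (node _ _) = 1

-- occ j t counts the occurrences of 12-3-…-(j+2) in flatten t, and occMax j l those in
-- flatten l followed by a new maximum.
mutual
  occ : ℕ → Tree → ℕ
  occ j leaf       = 0
  occ j (node l r) = occMax j l + occ j r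

  occMax : ℕ → Tree → ℕ
  occMax zero    l = occ zero l + nonLeaf l
  occMax (suc j) l = occ (suc j) l + occ j l

nonEmpty-flatten : ∀ t → nonEmpty (flatten t) ≡ nonLeaf t
nonEmpty-flatten leaf       = refl
nonEmpty-flatten (node l r) with flatten l
... | []    = refl
... | _ ∷ _ = refl

pat-flatten : ∀ j t → pat (2 + j) (flatten t) ≡ occ j t
pat-flatten j leaf       = refl
pat-flatten j (node l r) = begin
  pat (2 + j) (L ++ N ∷ flatten r)                 ≡⟨ cong (pat (2 + j)) (sym (++-assoc L [ N ] (flatten r))) ⟩
  pat (2 + j) ((L ++ [ N ]) ++ flatten r)          ≡⟨ pat-++-below (2 + j) (size r) (L ++ [ N ]) (flatten r) (flatten-bounded r)
                                                        (All.++⁺ (left-block-above l r) (ℕₚ.m≤n+m (size r) (size l) ∷ [])) ⟩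
  pat (2 + j) (L ++ [ N ]) + pat (2 + j) (flatten r) ≡⟨ cong₂ _+_ (left-block j) (pat-flatten j r) ⟩
  occMax j l + occ j r                             ∎
  where
  open ≡-Reasoning
  L = map (size r +_) (flatten l)
  N = size l + size r
  left-block : ∀ j → pat (2 + j) (L ++ [ N ]) ≡ occMax j l
  left-block zero
    rewrite pat₂-∷ʳ-max N L (left-block-bounded l r) | pat-shift 2 (size r) (flatten l) | pat-flatten zero l
          | nonEmpty-flatten (node leaf leaf) = cong (occ zero l +_) (trans (nonEmpty-map (flatten l)) (nonEmpty-flatten l))
    where
    nonEmpty-map : ∀ xs → nonEmpty (map (size r +_) xs) ≡ nonEmpty xs
    nonEmpty-map []      = refl
    nonEmpty-map (_ ∷ _) = refl
  left-block (suc j)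
    rewrite pat-∷ʳ-max j N L (left-block-bounded l r) | pat-shift (3 + j) (size r) (flatten l)
          | pat-shift (2 + j) (size r) (flatten l) | pat-flatten (suc j) l | pat-flatten j l = refl

occ-graft : ∀ j g x → occ j (graft g x) ≡ occ j g + occ j x
occ-graft j leaf         x = refl
occ-graft j (node g₁ g₂) x rewrite occ-graft j g₂ x = sym (ℕₚ.+-assoc (occMax j g₁) (occ j g₂) (occ j x))

nonLeaf-inv : ∀ t → nonLeaf (inv t) ≡ nonLeaf t
nonLeaf-inv leaf       = refl
nonLeaf-inv (node l r) with inv r
... | leaf     = refl
... | node _ _ = refl

occ-inv : ∀ j t → occ j (inv t) ≡ occ j t
occMax-inv : ∀ j t → occMax j (inv t) ≡ occMax j t
occMax-inv zero    t rewrite occ-inv zero t | nonLeaf-inv t = refl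
occMax-inv (suc j) t rewrite occ-inv (suc j) t | occ-inv j t = refl
occ-inv j leaf       = refl
occ-inv j (node l r) rewrite occ-graft j (inv r) (node (inv l) leaf) | occ-inv j r | occMax-inv j l =
  trans (cong (occ j r +_) (ℕₚ.+-identityʳ (occMax j l))) (ℕₚ.+-comm (occ j r) (occMax j l))

data Has32Above (a : ℕ) : List ℕ → Set where
  32-here  : ∀ {b cs} → Any (λ c → a < c × c < b) cs → Has32Above a (b ∷ cs)
  32-there : ∀ {b cs} → Has32Above a cs → Has32Above a (b ∷ cs)

data Contains132 : List ℕ → Set where
  132-here  : ∀ {a as} → Has32Above a as → Contains132 (a ∷ as)
  132-there : ∀ {a as} → Contains132 as → Contains132 (a ∷ as)

has32above-reflects : ∀ a xs → Reflects (Has32Above a xs) (has32above a xs)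
has32above-reflects a xs = fromEquivalence (sound xs) (complete xs)
  where
  test : ℕ → ℕ → Bool
  test b c = (a <ᵇ c) ∧ (c <ᵇ b)
  test-sound : ∀ {b c} → T (test b c) → a < c × c < b
  test-sound {b} {c} t with a<c , c<b ← Equivalence.to T-∧ t = ℕₚ.<ᵇ⇒< a c a<c , ℕₚ.<ᵇ⇒< c b c<b
  test-complete : ∀ {b c} → a < c × c < b → T (test b c)
  test-complete (a<c , c<b) = Equivalence.from T-∧ (ℕₚ.<⇒<ᵇ a<c , ℕₚ.<⇒<ᵇ c<b)
  sound : ∀ xs → T (has32above a xs) → Has32Above a xs
  sound (b ∷ cs) t with Equivalence.to T-∨ t
  ... | inj₁ t-here  = 32-here (Any.map test-sound (Any.any⁻ (test b) cs t-here))
  ... | inj₂ t-there = 32-there (sound cs t-there)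
  complete : ∀ xs → Has32Above a xs → T (has32above a xs)
  complete (b ∷ cs) (32-here p)  = Equivalence.from T-∨ (inj₁ (Any.any⁺ (test b) (Any.map test-complete p)))
  complete (b ∷ cs) (32-there p) = Equivalence.from T-∨ (inj₂ (complete cs p))

contains132-reflects : ∀ xs → Reflects (Contains132 xs) (contains132 xs)
contains132-reflects xs = fromEquivalence (sound xs) (complete xs)
  where
  sound : ∀ xs → T (contains132 xs) → Contains132 xs
  sound (a ∷ as) t with Equivalence.to T-∨ t
  ... | inj₁ t-here  = 132-here (fromT (has32above-reflects a as) t-here)
  ... | inj₂ t-there = 132-there (sound as t-there)
  complete : ∀ xs → Contains132 xs → T (contains132 xs)
  complete (a ∷ as) (132-here p)  = Equivalence.from T-∨ (inj₁ (toT (has32above-reflects a as) p))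
  complete (a ∷ as) (132-there p) = Equivalence.from T-∨ (inj₂ (complete as p))

avoids132? : ∀ xs → Dec (¬ Contains132 xs)
avoids132? xs = avoids132 xs because ¬-reflects (contains132-reflects xs)

32-witness : ∀ {a b cs} → Has32Above a (b ∷ cs) → ∃[ c ] c ∈ cs × a < c
32-witness (32-here p) with c , c∈ , (a<c , _) ← find p = c , c∈ , a<c
32-witness {cs = []}    (32-there ())
32-witness {cs = _ ∷ _} (32-there p) with c , c∈ , a<c ← 32-witness p = c , there c∈ , a<c

Has32Above-++⁻ : ∀ a xs ys → Has32Above a (xs ++ ys) →
                 Has32Above a xs ⊎ (∃[ b ] ∃[ c ] b ∈ xs × c ∈ ys × a < c × c < b) ⊎ Has32Above a ys
Has32Above-++⁻ a []       ys p            = inj₂ (inj₂ p)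
Has32Above-++⁻ a (b ∷ xs) ys (32-here p) with Any.++⁻ xs p
... | inj₁ p-xs = inj₁ (32-here p-xs)
... | inj₂ p-ys with c , c∈ , a<c<b ← find p-ys = inj₂ (inj₁ (b , c , here refl , c∈ , a<c<b))
Has32Above-++⁻ a (b ∷ xs) ys (32-there p) with Has32Above-++⁻ a xs ys p
... | inj₁ p-xs                              = inj₁ (32-there p-xs)
... | inj₂ (inj₁ (b′ , c , b′∈ , c∈ , a<c<b′)) = inj₂ (inj₁ (b′ , c , there b′∈ , c∈ , a<c<b′))
... | inj₂ (inj₂ p-ys)                       = inj₂ (inj₂ p-ys)

-- Every 132 in xs ++ M ∷ ys either lies in xs, lies in ys, or uses an entry of xs as its 1
-- together with a smaller entry of ys as its 2, which is impossible when xs lies above ys.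
avoids132-++-∷ : ∀ s M xs ys → ¬ Contains132 xs → ¬ Contains132 ys →
                 All (s ≤_) xs → All (_< M) xs → All (_< s) ys → s ≤ M → ¬ Contains132 (xs ++ M ∷ ys)
avoids132-++-∷ s M []       []       _ _ _ _ _ _ (132-here ())
avoids132-++-∷ s M []       (y ∷ ys) _ _ _ _ y∷ys<s s≤M (132-here p)
  with c , c∈ , M<c ← 32-witness p = ℕₚ.<-asym M<c (ℕₚ.<-≤-trans (All.lookup y∷ys<s (there c∈)) s≤M)
avoids132-++-∷ s M []       ys _    ¬ys _ _ _ _ (132-there p) = ¬ys p
avoids132-++-∷ s M (x ∷ xs) ys ¬x∷xs ¬ys (s≤x ∷ s≤xs) (x<M ∷ xs<M) ys<s s≤M (132-there p) =
  avoids132-++-∷ s M xs ys (¬x∷xs ∘ 132-there) ¬ys s≤xs xs<M ys<s s≤M p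
avoids132-++-∷ s M (x ∷ xs) ys ¬x∷xs ¬ys (s≤x ∷ _) (_ ∷ xs<M) ys<s s≤M (132-here p)
  with Has32Above-++⁻ x xs (M ∷ ys) p
... | inj₁ p-xs = ¬x∷xs (132-here p-xs)
... | inj₂ (inj₁ (b , _ , b∈ , here refl , _ , M<b)) = ℕₚ.<-asym M<b (All.lookup xs<M b∈)
... | inj₂ (inj₁ (_ , c , _ , there c∈ , x<c , _))  = ℕₚ.<-asym x<c (ℕₚ.<-≤-trans (All.lookup ys<s c∈) s≤x)
... | inj₂ (inj₂ p-ys) with c , c∈ , x<c ← 32-witness p-ys = ℕₚ.<-asym x<c (ℕₚ.<-≤-trans (All.lookup ys<s c∈) s≤x)

Contains132-shift⁻ : ∀ s xs → Contains132 (map (s +_) xs) → Contains132 xs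
Contains132-shift⁻ s (a ∷ as) (132-here p)  = 132-here (shift⁻ as p)
  where
  shift⁻ : ∀ xs → Has32Above (s + a) (map (s +_) xs) → Has32Above a xs
  shift⁻ (b ∷ cs) (32-here q)  =
    32-here (Any.map (λ (a<c , c<b) → ℕₚ.+-cancelˡ-< s _ _ a<c , ℕₚ.+-cancelˡ-< s _ _ c<b) (Any.map⁻ q))
  shift⁻ (b ∷ cs) (32-there q) = 32-there (shift⁻ cs q)
Contains132-shift⁻ s (a ∷ as) (132-there p) = 132-there (Contains132-shift⁻ s as p)

Contains132-shift⁺ : ∀ s xs → Contains132 xs → Contains132 (map (s +_) xs)
Contains132-shift⁺ s (a ∷ as) (132-here p)  = 132-here (shift⁺ as p)
  where
  shift⁺ : ∀ xs → Has32Above a xs → Has32Above (s + a) (map (s +_) xs)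
  shift⁺ (b ∷ cs) (32-here q)  =
    32-here (Any.map⁺ (Any.map (λ (a<c , c<b) → ℕₚ.+-monoʳ-< s a<c , ℕₚ.+-monoʳ-< s c<b) q))
  shift⁺ (b ∷ cs) (32-there q) = 32-there (shift⁺ cs q)
Contains132-shift⁺ s (a ∷ as) (132-there p) = 132-there (Contains132-shift⁺ s as p)

Contains132-++⁺ˡ : ∀ xs ys → Contains132 xs → Contains132 (xs ++ ys)
Contains132-++⁺ˡ (a ∷ as) ys (132-here p)  = 132-here (++⁺ˡ as p)
  where
  ++⁺ˡ : ∀ xs → Has32Above a xs → Has32Above a (xs ++ ys)
  ++⁺ˡ (b ∷ cs) (32-here q)  = 32-here (Any.++⁺ˡ q)
  ++⁺ˡ (b ∷ cs) (32-there q) = 32-there (++⁺ˡ cs q)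
Contains132-++⁺ˡ (a ∷ as) ys (132-there p) = 132-there (Contains132-++⁺ˡ as ys p)

Contains132-++⁺ʳ : ∀ xs ys → Contains132 ys → Contains132 (xs ++ ys)
Contains132-++⁺ʳ []       ys p = p
Contains132-++⁺ʳ (a ∷ xs) ys p = 132-there (Contains132-++⁺ʳ xs ys p)

Contains132-across : ∀ xs k ys {a b} → a ∈ xs → b ∈ ys → a < b → b < k → Contains132 (xs ++ k ∷ ys)
Contains132-across (x ∷ xs) k ys (here refl) b∈ a<b b<k = 132-here (across xs b∈)
  where
  across : ∀ zs → _ → Has32Above x (zs ++ k ∷ ys)
  across []       b∈ = 32-here (lose b∈ (a<b , b<k))
  across (z ∷ zs) b∈ = 32-there (across zs b∈)
Contains132-across (x ∷ xs) k ys (there a∈) b∈ a<b b<k = 132-there (Contains132-across xs k ys a∈ b∈ a<b b<k)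

IsPermutation : ℕ → List ℕ → Set
IsPermutation n π = length π ≡ n × All (_< n) π × Unique π

Unique-head : ∀ {x : ℕ} {xs} → Unique (x ∷ xs) → x ∉ xs
Unique-head (x≢xs ∷ _) = All.All¬⇒¬Any x≢xs

Unique-tail : ∀ {x : ℕ} {xs} → Unique (x ∷ xs) → Unique xs
Unique-tail (_ ∷ xs!) = xs!

Unique-concatMap : ∀ {A B : Set} (f : A → List B) {xs} → Unique xs → (∀ {x} → x ∈ xs → Unique (f x)) →
                   (∀ {x y z} → x ∈ xs → y ∈ xs → z ∈ f x → z ∈ f y → x ≡ y) → Unique (concatMap f xs)
Unique-concatMap f {[]}     _           _    _        = []
Unique-concatMap f {x ∷ xs} (x∉ ∷ xs!) f-uniq f-disj =
  Unique.++⁺ (f-uniq (here refl)) (Unique-concatMap f xs! (f-uniq ∘ there) (λ x∈ y∈ → f-disj (there x∈) (there y∈))) disjoint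
  where
  disjoint : ∀ {z} → ¬ (z ∈ f x × z ∈ concatMap f xs)
  disjoint (z∈fx , z∈rest) with y , y∈ , z∈fy ← find (∈-concatMap⁻ f {xs = xs} z∈rest) =
    All.All¬⇒¬Any x∉ (subst (_∈ xs) (sym (f-disj (here refl) (there y∈) z∈fx z∈fy)) y∈)

-- Pigeonhole: xs is a permutation of the sublist filter (_∈? xs) ys.
Unique-⊆⇒length-≤ : ∀ {xs ys : List ℕ} → Unique xs → Unique ys → (∀ {x} → x ∈ xs → x ∈ ys) →
                    length xs ≤ length ys
Unique-⊆⇒length-≤ {xs} {ys} xs! ys! xs⊆ys = begin
  length xs                    ≡⟨ ↭-length (∼bag⇒↭ (unique∧set⇒bag xs! (Unique.filter⁺ (_∈? xs) ys!)
                                                                       (mk⇔ to from))) ⟩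
  length (filter (_∈? xs) ys)  ≤⟨ length-filter (_∈? xs) ys ⟩
  length ys                    ∎
  where
  open ℕₚ.≤-Reasoning
  to : ∀ {x} → x ∈ xs → x ∈ filter (_∈? xs) ys
  to x∈ = ∈-filter⁺ (_∈? xs) (xs⊆ys x∈) x∈
  from : ∀ {x} → x ∈ filter (_∈? xs) ys → x ∈ xs
  from x∈ = proj₂ (∈-filter⁻ (_∈? xs) {xs = ys} x∈)

Unique-bounded⇒length-≤ : ∀ {xs n} → Unique xs → All (_< n) xs → length xs ≤ n
Unique-bounded⇒length-≤ {xs} {n} xs! xs<n =
  subst (length xs ≤_) (length-upTo n) (Unique-⊆⇒length-≤ xs! (Unique.upTo⁺ n) (∈-upTo⁺ ∘ All.lookup xs<n))

∈-words⁺ : ∀ l b w → length w ≡ l → All (_< b) w → w ∈ words l b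
∈-words⁺ zero    b []      refl []           = here refl
∈-words⁺ (suc l) b (v ∷ w) refl (v<b ∷ w<b) =
  ∈-concatMap⁺ (λ u → map (u ∷_) (words l b)) {xs = upTo b}
               (lose (∈-upTo⁺ v<b) (∈-map⁺ (v ∷_) (∈-words⁺ l b w refl w<b)))

∈-words⁻ : ∀ l b w → w ∈ words l b → length w ≡ l × All (_< b) w
∈-words⁻ zero    b [] (here refl) = refl , []
∈-words⁻ (suc l) b w  w∈
  with v , v∈ , w∈′ ← find (∈-concatMap⁻ (λ u → map (u ∷_) (words l b)) {xs = upTo b} w∈)
  with w′ , w′∈ , refl ← ∈-map⁻ (v ∷_) w∈′
  with |w′|≡l , w′<b ← ∈-words⁻ l b w′ w′∈ = cong suc |w′|≡l , ∈-upTo⁻ v∈ ∷ w′<b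

Unique-words : ∀ l b → Unique (words l b)
Unique-words zero    b = [] ∷ []
Unique-words (suc l) b = Unique-concatMap (λ u → map (u ∷_) (words l b)) (Unique.upTo⁺ b)
  (λ _ → Unique.map⁺ (proj₂ ∘ ∷-injective) (Unique-words l b)) same-head
  where
  same-head : ∀ {x y z} → _ → _ → z ∈ map (x ∷_) (words l b) → z ∈ map (y ∷_) (words l b) → x ≡ y
  same-head _ _ z∈x z∈y with _ , _ , refl ← ∈-map⁻ _ z∈x | _ , _ , eq ← ∈-map⁻ _ z∈y = proj₁ (∷-injective eq)

T-not⇒¬T : ∀ {b} → T (not b) → ¬ T b
T-not⇒¬T {false} _ ()

¬T⇒T-not : ∀ {b} → ¬ T b → T (not b)
¬T⇒T-not {true}  ¬t = ¬t _
¬T⇒T-not {false} _  = _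

allDistinct-reflects : ∀ w → Reflects (Unique w) (allDistinct w)
allDistinct-reflects w = fromEquivalence (sound w) (complete w)
  where
  sound : ∀ w → T (allDistinct w) → Unique w
  sound []      _ = []
  sound (x ∷ w) t with fresh , rest ← Equivalence.to T-∧ t =
    All.¬Any⇒All¬ w (T-not⇒¬T fresh ∘ Any.any⁺ (x ≡ᵇ_) ∘ Any.map (ℕₚ.≡⇒≡ᵇ x _)) ∷ sound w rest
  complete : ∀ w → Unique w → T (allDistinct w)
  complete []      _          = _
  complete (x ∷ w) (x∉ ∷ w!) =
    Equivalence.from T-∧
      (¬T⇒T-not (All.All¬⇒¬Any x∉ ∘ Any.map (ℕₚ.≡ᵇ⇒≡ x _) ∘ Any.any⁻ (x ≡ᵇ_) w) , complete w w!)

∈-perms⁺ : ∀ n π → IsPermutation n π → π ∈ perms n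
∈-perms⁺ n π (|π|≡n , π<n , π!) =
  ∈-filter⁺ (T? ∘ allDistinct) (∈-words⁺ n n π |π|≡n π<n) (toT (allDistinct-reflects π) π!)

∈-perms⁻ : ∀ n π → π ∈ perms n → IsPermutation n π
∈-perms⁻ n π π∈ with π∈words , distinct ← ∈-filter⁻ (T? ∘ allDistinct) {xs = words n n} π∈
                 with |π|≡n , π<n ← ∈-words⁻ n n π π∈words = |π|≡n , π<n , fromT (allDistinct-reflects π) distinct

Unique-perms : ∀ n → Unique (perms n)
Unique-perms n = Unique.filter⁺ (T? ∘ allDistinct) (Unique-words n n)

-- Trees are the 132-avoiding permutations

bounded⇒∉ : ∀ {n xs} → All (_< n) xs → n ∉ xs
bounded⇒∉ {n} xs<n n∈xs = ℕₚ.n≮n n (All.lookup xs<n n∈xs)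

Unique-flatten : ∀ t → Unique (flatten t)
Unique-flatten leaf       = []
Unique-flatten (node l r) =
  Unique.++⁺ (Unique.map⁺ (ℕₚ.+-cancelˡ-≡ (size r) _ _) (Unique-flatten l))
             (All.¬Any⇒All¬ (flatten r)
                (bounded⇒∉ (All.map (λ v<r → ℕₚ.<-≤-trans v<r (ℕₚ.m≤n+m (size r) (size l))) (flatten-bounded r)))
              ∷ Unique-flatten r)
             disjoint
  where
  disjoint : ∀ {v} → ¬ (v ∈ map (size r +_) (flatten l) × v ∈ (size l + size r) ∷ flatten r)
  disjoint (v∈L , here refl) = bounded⇒∉ (left-block-bounded l r) v∈L
  disjoint (v∈L , there v∈R) = ℕₚ.<⇒≱ (All.lookup (flatten-bounded r) v∈R) (All.lookup (left-block-above l r) v∈L)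

avoids132-flatten : ∀ t → ¬ Contains132 (flatten t)
avoids132-flatten leaf       ()
avoids132-flatten (node l r) =
  avoids132-++-∷ (size r) (size l + size r) (map (size r +_) (flatten l)) (flatten r)
    (avoids132-flatten l ∘ Contains132-shift⁻ (size r) (flatten l)) (avoids132-flatten r)
    (left-block-above l r) (left-block-bounded l r) (flatten-bounded r) (ℕₚ.m≤n+m (size r) (size l))

flatten-isPermutation : ∀ t → IsPermutation (size t) (flatten t)
flatten-isPermutation t = length-flatten t , flatten-bounded t , Unique-flatten t

++-∷-cancel : ∀ {M : ℕ} xs ys xs′ ys′ → xs ++ M ∷ ys ≡ xs′ ++ M ∷ ys′ → M ∉ xs → M ∉ xs′ →
              xs ≡ xs′ × ys ≡ ys′
++-∷-cancel []       ys []         ys′ eq _    _     = refl , proj₂ (∷-injective eq)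
++-∷-cancel []       ys (x′ ∷ xs′) ys′ eq _    M∉xs′ = ⊥-elim (M∉xs′ (here (proj₁ (∷-injective eq))))
++-∷-cancel (x ∷ xs) ys []         ys′ eq M∉xs _     = ⊥-elim (M∉xs (here (sym (proj₁ (∷-injective eq)))))
++-∷-cancel (x ∷ xs) ys (x′ ∷ xs′) ys′ eq M∉xs M∉xs′
  with refl , eq′ ← ∷-injective eq
  with refl , refl ← ++-∷-cancel xs ys xs′ ys′ eq′ (M∉xs ∘ there) (M∉xs′ ∘ there) = refl , refl

[]≢++-∷ : ∀ (xs : List ℕ) y ys → ¬ [] ≡ xs ++ y ∷ ys
[]≢++-∷ []      y ys ()
[]≢++-∷ (_ ∷ _) y ys ()

flatten-injective : Injective _≡_ _≡_ flatten
flatten-injective {leaf}     {leaf}       _  = refl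
flatten-injective {leaf}     {node l r}   eq = ⊥-elim ([]≢++-∷ _ _ _ eq)
flatten-injective {node l r} {leaf}       eq = ⊥-elim ([]≢++-∷ _ _ _ (sym eq))
flatten-injective {node l r} {node l′ r′} eq = cong₂ node (flatten-injective flatten-l) r≡r′
  where
  N≡N′ : size l + size r ≡ size l′ + size r′
  N≡N′ = ℕₚ.suc-injective (trans (sym (length-flatten (node l r))) (trans (cong length eq) (length-flatten (node l′ r′))))
  blocks : map (size r +_) (flatten l) ≡ map (size r′ +_) (flatten l′) × flatten r ≡ flatten r′
  blocks = ++-∷-cancel _ _ _ _ (trans eq (cong (λ N → map (size r′ +_) (flatten l′) ++ N ∷ flatten r′) (sym N≡N′)))
             (bounded⇒∉ (left-block-bounded l r))
             (bounded⇒∉ (subst (λ N → All (_< N) (map (size r′ +_) (flatten l′))) (sym N≡N′) (left-block-bounded l′ r′)))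
  r≡r′ : r ≡ r′
  r≡r′ = flatten-injective (proj₂ blocks)
  flatten-l : flatten l ≡ flatten l′
  flatten-l = map-injective (ℕₚ.+-cancelˡ-≡ (size r) _ _)
                            (trans (proj₁ blocks) (cong (λ t → map (size t +_) (flatten l′)) (sym r≡r′)))

Unique-++⁻ : ∀ xs {ys : List ℕ} → Unique (xs ++ ys) → Unique xs × Unique ys × (∀ {v} → v ∈ xs → v ∉ ys)
Unique-++⁻ []       ys!        = [] , ys! , λ ()
Unique-++⁻ (x ∷ xs) (x∉ ∷ xys!) with xs! , ys! , disjoint ← Unique-++⁻ xs xys! | x∉xs , x∉ys ← All.++⁻ xs x∉ =
  x∉xs ∷ xs! , ys! , λ { (here refl) → All.All¬⇒¬Any x∉ys ; (there v∈) → disjoint v∈ }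

<1+∧≢⇒< : ∀ {x k} → x < suc k → x ≢ k → x < k
<1+∧≢⇒< x<1+k = ℕₚ.≤∧≢⇒< (ℕₚ.≤-pred x<1+k)

max-∈ : ∀ {k π} → IsPermutation (suc k) π → k ∈ π
max-∈ {k} {π} (|π|≡1+k , π<1+k , π!) with k ∈? π
... | yes k∈π = k∈π
... | no  k∉π = ⊥-elim (ℕₚ.<⇒≱ (ℕₚ.≤-reflexive (sym |π|≡1+k)) (Unique-bounded⇒length-≤ π! π<k))
  where
  π<k : All (_< k) π
  π<k = All.tabulate (λ {x} x∈π → <1+∧≢⇒< (All.lookup π<1+k x∈π) (λ x≡k → k∉π (subst (_∈ π) x≡k x∈π)))

-- Avoiding 132 puts every entry before the maximum k above every entry after it, and counting
-- (pigeonhole) then shows that the entries after k are exactly 0, …, |B| - 1.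
module MaxSplit {k} A B (perm : IsPermutation (suc k) (A ++ k ∷ B)) (avoids : ¬ Contains132 (A ++ k ∷ B)) where

  private
    s = length B
    π! = proj₂ (proj₂ perm)
    π<1+k = proj₁ (proj₂ perm)
    split! = Unique-++⁻ A π!
    A! = proj₁ split!
    B! = Unique-tail (proj₁ (proj₂ split!))
    k∉B = Unique-head (proj₁ (proj₂ split!))
    A#k∷B : ∀ {v} → v ∈ A → v ∉ k ∷ B
    A#k∷B = proj₂ (proj₂ split!)

  |A|+|B|≡k : length A + s ≡ k
  |A|+|B|≡k = ℕₚ.suc-injective (trans (sym (ℕₚ.+-suc (length A) s)) (trans (sym (length-++ A)) (proj₁ perm)))

  A<k : All (_< k) A
  A<k = All.tabulate λ {a} a∈ →
    <1+∧≢⇒< (All.lookup (proj₁ (All.++⁻ A π<1+k)) a∈) (λ a≡k → A#k∷B a∈ (here a≡k))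

  B<k : All (_< k) B
  B<k = All.tabulate λ {b} b∈ →
    <1+∧≢⇒< (All.lookup (proj₂ (All.++⁻ A π<1+k)) (there b∈)) (λ b≡k → k∉B (subst (_∈ B) b≡k b∈))

  B<A : ∀ {a b} → a ∈ A → b ∈ B → b < a
  B<A {a} {b} a∈ b∈ with ℕₚ.<-cmp a b
  ... | tri< a<b _ _ = ⊥-elim (avoids (Contains132-across A k B a∈ b∈ a<b (All.lookup B<k b∈)))
  ... | tri≈ _ refl _ = ⊥-elim (A#k∷B a∈ (there b∈))
  ... | tri> _ _ b<a = b<a

  |B|≤A : All (s ≤_) A
  |B|≤A = All.tabulate λ a∈ → Unique-bounded⇒length-≤ B! (All.tabulate (B<A a∈))

  B<|B| : All (_< s) B
  B<|B| = All.tabulate λ {b} b∈ → ℕₚ.+-cancelˡ-≤ (length A) (suc b) s (begin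
    length A + suc b            ≤⟨ ℕₚ.+-monoˡ-≤ (suc b) (|A|≤ b b∈) ⟩
    (k ∸ suc b) + suc b         ≡⟨ ℕₚ.m∸n+n≡m (All.lookup B<k b∈) ⟩
    k                           ≡⟨ sym |A|+|B|≡k ⟩
    length A + s                ∎)
    where
    open ℕₚ.≤-Reasoning
    |A|≤ : ∀ b → b ∈ B → length A ≤ k ∸ suc b
    |A|≤ b b∈ = ℕₚ.≤-trans
      (Unique-⊆⇒length-≤ A! (Unique.map⁺ (ℕₚ.+-cancelˡ-≡ (suc b) _ _) (Unique.upTo⁺ (k ∸ suc b))) A⊆)
      (ℕₚ.≤-reflexive (trans (length-map _ (upTo (k ∸ suc b))) (length-upTo (k ∸ suc b))))
      where
      A⊆ : ∀ {a} → a ∈ A → a ∈ map (suc b +_) (upTo (k ∸ suc b))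
      A⊆ {a} a∈ = subst (_∈ _) (ℕₚ.m+[n∸m]≡n (B<A a∈ b∈))
        (∈-map⁺ (suc b +_) (∈-upTo⁺ (ℕₚ.∸-monoˡ-< (All.lookup A<k a∈) (B<A a∈ b∈))))

  A≡ : map (s +_) (map (_∸ s) A) ≡ A
  A≡ = trans (sym (map-∘ A)) (trans (map-cong-local (All.map ℕₚ.m+[n∸m]≡n |B|≤A)) (map-id A))

  A-isPermutation : IsPermutation (length A) (map (_∸ s) A)
  A-isPermutation = length-map _ A
    , All.map⁺ (All.zipWith (λ (s≤a , a<k) → subst (_ <_) (trans (cong (_∸ s) (sym |A|+|B|≡k)) (ℕₚ.m+n∸n≡m (length A) s))
                                                   (ℕₚ.∸-monoˡ-< a<k s≤a)) (|B|≤A , A<k))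
    , Unique.map⁻ (subst Unique (sym A≡) A!)

  B-isPermutation : IsPermutation s B
  B-isPermutation = refl , B<|B| , B!

  A-avoids132 : ¬ Contains132 (map (_∸ s) A)
  A-avoids132 = avoids ∘ Contains132-++⁺ˡ A (k ∷ B) ∘ subst Contains132 A≡ ∘ Contains132-shift⁺ s _

  B-avoids132 : ¬ Contains132 B
  B-avoids132 = avoids ∘ Contains132-++⁺ʳ A (k ∷ B) ∘ 132-there

unflatten : ∀ n π → IsPermutation n π → ¬ Contains132 π → ∃[ t ] flatten t ≡ π
unflatten = <-rec _ go
  where
  go : ∀ n → (∀ {m} → m < n → ∀ π → IsPermutation m π → ¬ Contains132 π → ∃[ t ] flatten t ≡ π) →
       ∀ π → IsPermutation n π → ¬ Contains132 π → ∃[ t ] flatten t ≡ π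
  go zero    _   []      _ _ = leaf , refl
  go (suc k) rec π perm avoids with A , B , refl ← ∈-∃++ (max-∈ perm) = node tA tB , flatten-tA∷tB
    where
    open MaxSplit A B perm avoids
    recA = rec (ℕₚ.≤-trans (s≤s (ℕₚ.m≤m+n (length A) (length B))) (ℕₚ.≤-reflexive (cong suc |A|+|B|≡k)))
               _ A-isPermutation A-avoids132
    recB = rec (ℕₚ.≤-trans (s≤s (ℕₚ.m≤n+m (length B) (length A))) (ℕₚ.≤-reflexive (cong suc |A|+|B|≡k)))
               B B-isPermutation B-avoids132
    tA = proj₁ recA
    tB = proj₁ recB
    |tB|≡|B| : size tB ≡ length B
    |tB|≡|B| = trans (sym (length-flatten tB)) (cong length (proj₂ recB))
    |tA|≡|A| : size tA ≡ length A
    |tA|≡|A| = trans (sym (length-flatten tA)) (trans (cong length (proj₂ recA)) (length-map _ A))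
    flatten-tA∷tB : flatten (node tA tB) ≡ A ++ k ∷ B
    flatten-tA∷tB rewrite proj₂ recA | proj₂ recB | |tA|≡|A| | |tB|≡|B| | |A|+|B|≡k | A≡ = refl

-- Involutions are the self-inverse trees

at-++ˡ : ∀ {i} (xs ys : List ℕ) → i < length xs → at i (xs ++ ys) ≡ at i xs
at-++ˡ {zero}  (x ∷ xs) ys _   = refl
at-++ˡ {suc i} (x ∷ xs) ys i<n = at-++ˡ xs ys (ℕₚ.≤-pred i<n)

at-++ʳ : ∀ i (xs ys : List ℕ) → at (length xs + i) (xs ++ ys) ≡ at i ys
at-++ʳ i []       ys = refl
at-++ʳ i (x ∷ xs) ys = at-++ʳ i xs ys

at-map : ∀ (f : ℕ → ℕ) {i} xs → i < length xs → at i (map f xs) ≡ f (at i xs)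
at-map f {zero}  (x ∷ xs) _   = refl
at-map f {suc i} (x ∷ xs) i<n = at-map f xs (ℕₚ.≤-pred i<n)

at-∈ : ∀ {i} xs → i < length xs → at i xs ∈ xs
at-∈ {zero}  (x ∷ xs) _   = here refl
at-∈ {suc i} (x ∷ xs) i<n = there (at-∈ xs (ℕₚ.≤-pred i<n))

at-ext : ∀ (xs ys : List ℕ) → length xs ≡ length ys → (∀ i → i < length xs → at i xs ≡ at i ys) → xs ≡ ys
at-ext []       []       _       _  = refl
at-ext (x ∷ xs) (y ∷ ys) |xs|≡|ys| xs≗ys =
  cong₂ _∷_ (xs≗ys 0 (s≤s z≤n)) (at-ext xs ys (ℕₚ.suc-injective |xs|≡|ys|) (λ i i<n → xs≗ys (suc i) (s≤s i<n)))

length-flatten-inv : ∀ t → length (flatten (inv t)) ≡ size t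
length-flatten-inv t = trans (length-flatten (inv t)) (size-inv t)

at-flatten-bounded : ∀ t {i} → i < size t → at i (flatten t) < size t
at-flatten-bounded t i<n = All.lookup (flatten-bounded t) (at-∈ (flatten t) (subst (_ <_) (sym (length-flatten t)) i<n))

module _ (l r : Tree) where

  private
    L = map (size r +_) (flatten l)
    |L|≡|l| : length L ≡ size l
    |L|≡|l| = trans (length-map _ (flatten l)) (length-flatten l)
    R⁻¹ = map (suc (size l) +_) (flatten (inv r))
    |R⁻¹|≡|r| : length R⁻¹ ≡ size r
    |R⁻¹|≡|r| = trans (length-map _ (flatten (inv r))) (length-flatten-inv r)

  flatten-inv-node : flatten (inv (node l r)) ≡ R⁻¹ ++ flatten (inv l) ++ [ size l ]
  flatten-inv-node
    rewrite flatten-graft (inv r) (node (inv l) leaf) | size-inv l | ℕₚ.+-identityʳ (size l)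
          | map-id-local {f = 0 +_} (All.universal (λ _ → refl) (flatten (inv l))) = refl

  at-flatten-node-left : ∀ {i} → i < size l → at i (flatten (node l r)) ≡ size r + at i (flatten l)
  at-flatten-node-left i<l = trans (at-++ˡ L _ (subst (_ <_) (sym |L|≡|l|) i<l))
                                   (at-map (size r +_) (flatten l) (subst (_ <_) (sym (length-flatten l)) i<l))

  at-flatten-node-root : at (size l) (flatten (node l r)) ≡ size l + size r
  at-flatten-node-root = subst (λ n → at n (flatten (node l r)) ≡ size l + size r)
                               (trans (ℕₚ.+-identityʳ _) |L|≡|l|) (at-++ʳ 0 L _)

  at-flatten-node-right : ∀ j → at (suc (size l) + j) (flatten (node l r)) ≡ at j (flatten r)
  at-flatten-node-right j = subst (λ n → at n (flatten (node l r)) ≡ at j (flatten r))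
                                  (trans (ℕₚ.+-suc _ j) (cong (λ n → suc n + j) |L|≡|l|)) (at-++ʳ (suc j) L _)

  at-flatten-inv-node-low : ∀ {v} → v < size r → at v (flatten (inv (node l r))) ≡ suc (size l) + at v (flatten (inv r))
  at-flatten-inv-node-low v<r rewrite flatten-inv-node =
    trans (at-++ˡ R⁻¹ _ (subst (_ <_) (sym |R⁻¹|≡|r|) v<r))
          (at-map (suc (size l) +_) (flatten (inv r)) (subst (_ <_) (sym (length-flatten-inv r)) v<r))

  at-flatten-inv-node-high : ∀ v → at (size r + v) (flatten (inv (node l r))) ≡ at v (flatten (inv l) ++ [ size l ])
  at-flatten-inv-node-high v rewrite flatten-inv-node =
    subst (λ n → at (n + v) (R⁻¹ ++ _) ≡ at v (flatten (inv l) ++ [ size l ])) |R⁻¹|≡|r| (at-++ʳ v R⁻¹ _)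

flatten-inv-inverse : ∀ t {i} → i < size t → at (at i (flatten t)) (flatten (inv t)) ≡ i
flatten-inv-inverse (node l r) {i} i<n with ℕₚ.<-cmp i (size l)
... | tri< i<l _ _ = begin
  at (at i (flatten (node l r))) σ                       ≡⟨ cong (λ v → at v σ) (at-flatten-node-left l r i<l) ⟩
  at (size r + v) σ                                      ≡⟨ at-flatten-inv-node-high l r v ⟩
  at v (flatten (inv l) ++ [ size l ])                   ≡⟨ at-++ˡ (flatten (inv l)) _ v<|l⁻¹| ⟩
  at v (flatten (inv l))                                 ≡⟨ flatten-inv-inverse l i<l ⟩
  i                                                      ∎
  where
  open ≡-Reasoning
  σ = flatten (inv (node l r))
  v = at i (flatten l)
  v<|l⁻¹| : v < length (flatten (inv l))
  v<|l⁻¹| = subst (v <_) (sym (length-flatten-inv l)) (at-flatten-bounded l i<l)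
... | tri≈ _ refl _ = begin
  at (at (size l) (flatten (node l r))) σ                ≡⟨ cong (λ v → at v σ) (trans (at-flatten-node-root l r)
                                                                                     (ℕₚ.+-comm (size l) (size r))) ⟩
  at (size r + size l) σ                                 ≡⟨ at-flatten-inv-node-high l r (size l) ⟩
  at (size l) (flatten (inv l) ++ [ size l ])            ≡⟨ subst (λ n → at n (flatten (inv l) ++ [ size l ]) ≡ size l)
                                                                   (trans (ℕₚ.+-identityʳ _) (length-flatten-inv l))
                                                                   (at-++ʳ 0 (flatten (inv l)) _) ⟩
  size l                                                 ∎
  where
  open ≡-Reasoning
  σ = flatten (inv (node l r))
... | tri> _ _ l<i = begin
  at (at i (flatten (node l r))) σ                       ≡⟨ cong (λ n → at (at n (flatten (node l r))) σ) (sym i≡) ⟩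
  at (at (suc (size l) + j) (flatten (node l r))) σ      ≡⟨ cong (λ v → at v σ) (at-flatten-node-right l r j) ⟩
  at w σ                                                 ≡⟨ at-flatten-inv-node-low l r (at-flatten-bounded r j<r) ⟩
  suc (size l) + at w (flatten (inv r))                  ≡⟨ cong (suc (size l) +_) (flatten-inv-inverse r j<r) ⟩
  suc (size l) + j                                       ≡⟨ i≡ ⟩
  i                                                      ∎
  where
  open ≡-Reasoning
  σ = flatten (inv (node l r))
  j = i ∸ suc (size l)
  i≡ : suc (size l) + j ≡ i
  i≡ = ℕₚ.m+[n∸m]≡n l<i
  j<r : j < size r
  j<r = ℕₚ.+-cancelˡ-< (suc (size l)) j (size r) (subst (_< suc (size l) + size r) (sym i≡) i<n)
  w = at j (flatten r)

isInvolution-reflects : ∀ t → Reflects (t ≡ inv t) (isInvolution (flatten t))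
isInvolution-reflects t = fromEquivalence sound complete
  where
  π = flatten t
  σ = flatten (inv t)
  |π|≡|t| = length-flatten t
  |σ|≡|t| = length-flatten-inv t
  complete : t ≡ inv t → T (isInvolution π)
  complete t≡t⁻¹ = All.all⁻ _ (All.tabulate λ {i} i∈ →
    ℕₚ.≡⇒≡ᵇ _ _ (trans (cong (λ u → at (at i π) (flatten u)) t≡t⁻¹)
                        (flatten-inv-inverse t (subst (i <_) |π|≡|t| (∈-upTo⁻ i∈)))))
  sound : T (isInvolution π) → t ≡ inv t
  sound π∘π≡id = flatten-injective (at-ext π σ (trans |π|≡|t| (sym |σ|≡|t|)) π≗σ)
    where
    π∘π : ∀ {x} → x < size t → at (at x π) π ≡ x
    π∘π {x} x<n = ℕₚ.≡ᵇ⇒≡ _ _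
      (All.lookup (All.all⁺ _ (upTo (length π)) π∘π≡id) (∈-upTo⁺ (subst (x <_) (sym |π|≡|t|) x<n)))
    π∘σ : ∀ {x} → x < size t → at (at x σ) π ≡ x
    π∘σ {x} x<n = subst (λ u → at (at x σ) (flatten u) ≡ x) (inv-involutive t)
                        (flatten-inv-inverse (inv t) (subst (x <_) (sym (size-inv t)) x<n))
    π≗σ : ∀ i → i < length π → at i π ≡ at i σ
    π≗σ i i<|π| = trans (cong (λ x → at x π) (sym (π∘σ i<n))) (π∘π σᵢ<n)
      where
      i<n = subst (i <_) |π|≡|t| i<|π|
      σᵢ<n = subst (at i σ <_) (size-inv t) (at-flatten-bounded (inv t) (subst (i <_) (sym (size-inv t)) i<n))

mutual
  trees≤ : ℕ → List Tree
  trees≤ H = leaf ∷ nodes≤ H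

  nodes≤ : ℕ → List Tree
  nodes≤ zero    = []
  nodes≤ (suc H) = concatMap (nodesWithLeft H) (trees≤ H)

  nodesWithLeft : ℕ → Tree → List Tree
  nodesWithLeft H l = map (node l) (filter (λ r → size l + size r ≤? H) (trees≤ H))

∈-nodes≤⁻ : ∀ H {t} → t ∈ nodes≤ H → ∃[ l ] ∃[ r ] t ≡ node l r × size l + size r < H
∈-nodes≤⁻ (suc H) t∈
  with l , _ , t∈l ← find (∈-concatMap⁻ (nodesWithLeft H) {xs = trees≤ H} t∈)
  with r , r∈ , refl ← ∈-map⁻ (node l) t∈l =
    l , r , refl , s≤s (proj₂ (∈-filter⁻ (λ r → size l + size r ≤? H) {xs = trees≤ H} r∈))

∈-nodes≤⇒nonLeaf : ∀ H {t} → t ∈ nodes≤ H → nonLeaf t ≡ 1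
∈-nodes≤⇒nonLeaf H t∈ with _ , _ , refl , _ ← ∈-nodes≤⁻ H t∈ = refl

∈-trees≤⁻ : ∀ H {t} → t ∈ trees≤ H → size t ≤ H
∈-trees≤⁻ H (here refl) = z≤n
∈-trees≤⁻ H (there t∈) with _ , _ , refl , |t|≤H ← ∈-nodes≤⁻ H t∈ = |t|≤H

∈-trees≤⁺ : ∀ H t → size t ≤ H → t ∈ trees≤ H
∈-trees≤⁺ H       leaf       _             = here refl
∈-trees≤⁺ (suc H) (node l r) (s≤s |l|+|r|≤H) = there (∈-concatMap⁺ (nodesWithLeft H) {xs = trees≤ H}
  (lose (∈-trees≤⁺ H l (ℕₚ.≤-trans (ℕₚ.m≤m+n (size l) (size r)) |l|+|r|≤H))
        (∈-map⁺ (node l) (∈-filter⁺ (λ r → size l + size r ≤? H)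
                                    (∈-trees≤⁺ H r (ℕₚ.≤-trans (ℕₚ.m≤n+m (size r) (size l)) |l|+|r|≤H)) |l|+|r|≤H))))

Unique-trees≤ : ∀ H → Unique (trees≤ H)
Unique-nodes≤ : ∀ H → Unique (nodes≤ H)
Unique-trees≤ H = All.¬Any⇒All¬ (nodes≤ H) leaf∉ ∷ Unique-nodes≤ H
  where
  leaf∉ : leaf ∉ nodes≤ H
  leaf∉ leaf∈ with _ , _ , () , _ ← ∈-nodes≤⁻ H leaf∈
Unique-nodes≤ zero    = []
Unique-nodes≤ (suc H) = Unique-concatMap (nodesWithLeft H) (Unique-trees≤ H)
  (λ {l} _ → Unique.map⁺ (proj₂ ∘ node-injective) (Unique.filter⁺ (λ r → size l + size r ≤? H) (Unique-trees≤ H)))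
  same-left
  where
  same-left : ∀ {l l′ t} → _ → _ → t ∈ map (node l) _ → t ∈ map (node l′) _ → l ≡ l′
  same-left {l} {l′} _ _ t∈l t∈l′ with _ , _ , refl ← ∈-map⁻ (node l) t∈l | _ , _ , eq ← ∈-map⁻ (node l′) t∈l′ =
    proj₁ (node-injective eq)

avoiders≤ : ℕ → List (List ℕ)
avoiders≤ H = concatMap (λ n → filter avoids132? (perms n)) (upTo (suc H))

∑-avoiders≤ : ∀ H (f : List ℕ → ℤ) → ∑ (avoiders≤ H) f ≡ ∑[ t ∈ trees≤ H ] f (flatten t)
∑-avoiders≤ H = ∑-bijection flatten flatten-injective (Unique-trees≤ H) avoiders≤! into onto
  where
  avoiders≤! : Unique (avoiders≤ H)
  avoiders≤! = Unique-concatMap _ (Unique.upTo⁺ (suc H)) (λ {n} _ → Unique.filter⁺ avoids132? (Unique-perms n)) same-length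
    where
    same-length : ∀ {n n′ π} → _ → _ → π ∈ filter avoids132? (perms n) → π ∈ filter avoids132? (perms n′) → n ≡ n′
    same-length {n} {n′} {π} _ _ π∈n π∈n′ =
      trans (sym (proj₁ (∈-perms⁻ n π (proj₁ (∈-filter⁻ avoids132? {xs = perms n} π∈n)))))
            (proj₁ (∈-perms⁻ n′ π (proj₁ (∈-filter⁻ avoids132? {xs = perms n′} π∈n′))))
  into : ∀ {t} → t ∈ trees≤ H → flatten t ∈ avoiders≤ H
  into {t} t∈ = ∈-concatMap⁺ (λ n → filter avoids132? (perms n)) {xs = upTo (suc H)}
    (lose (∈-upTo⁺ (s≤s (∈-trees≤⁻ H t∈)))
          (∈-filter⁺ avoids132? (∈-perms⁺ (size t) (flatten t) (flatten-isPermutation t)) (avoids132-flatten t)))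
  onto : ∀ {π} → π ∈ avoiders≤ H → ∃[ t ] t ∈ trees≤ H × π ≡ flatten t
  onto {π} π∈
    with n , n∈ , π∈n ← find (∈-concatMap⁻ (λ n → filter avoids132? (perms n)) {xs = upTo (suc H)} π∈)
    with π∈perms , avoids ← ∈-filter⁻ avoids132? {xs = perms n} π∈n
    with t , refl ← unflatten n π (∈-perms⁻ n π π∈perms) avoids =
      t , ∈-trees≤⁺ H t (subst (_≤ H) (sym (trans (sym (length-flatten t)) (proj₁ (∈-perms⁻ n _ π∈perms))))
                                      (ℕₚ.≤-pred (∈-upTo⁻ n∈))) , refl

incAbove-short : ∀ c v xs → length xs < c → incAbove c v xs ≡ 0
incAbove-short (suc c) v []       _           = refl
incAbove-short (suc c) v (x ∷ xs) (s≤s |xs|<c) with v <ᵇ x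
... | true  = cong₂ _+_ (incAbove-short c x xs |xs|<c) (incAbove-short (suc c) v xs (ℕₚ.m<n⇒m<1+n |xs|<c))
... | false = incAbove-short (suc c) v xs (ℕₚ.m<n⇒m<1+n |xs|<c)

pat-short : ∀ j π → length π ≤ suc j → pat (2 + j) π ≡ 0
pat-short j []            _          = refl
pat-short j (a ∷ [])      _          = refl
pat-short j (a ∷ b ∷ π) (s≤s |b∷π|≤1+j) =
  cong₂ _+_ first (pat-short j (b ∷ π) (ℕₚ.m≤n⇒m≤1+n |b∷π|≤1+j))
  where
  first : (if a <ᵇ b then incAbove j b π else 0) ≡ 0
  first with a <ᵇ b
  ... | true  = incAbove-short j b π |b∷π|≤1+j
  ... | false = refl

deg-applyUpTo : ∀ (f : ℕ → ℕ) n j → deg (applyUpTo f n) j ≡ (if j <ᵇ n then f j else 0)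
deg-applyUpTo f zero    j       = refl
deg-applyUpTo f (suc n) zero    = refl
deg-applyUpTo f (suc n) (suc j) = deg-applyUpTo (f ∘ suc) n j

deg-expVec-suc : ∀ π j → deg (expVec π) (suc j) ≡ pat (2 + j) π
deg-expVec-suc π j
  rewrite map-upTo (λ j → pat (2 + j) π) (length π ∸ 1) | deg-applyUpTo (λ j → pat (2 + j) π) (length π ∸ 1) j
  with j <ᵇ (length π ∸ 1) | ℕₚ.<ᵇ-reflects-< j (length π ∸ 1)
... | true  | _      = refl
... | false | ofⁿ j≮ = sym (pat-short j π (ℕₚ.≤-trans (ℕₚ.m≤n+m∸n (length π) 1) (s≤s (ℕₚ.≮⇒≥ j≮))))

treeDeg : Tree → ℕ → ℕ
treeDeg t zero    = size t
treeDeg t (suc j) = occ j t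

deg-expVec-flatten : ∀ t i → deg (expVec (flatten t)) i ≡ treeDeg t i
deg-expVec-flatten t zero    = length-flatten t
deg-expVec-flatten t (suc j) = trans (deg-expVec-suc (flatten t) j) (pat-flatten j t)

deg-map-* : ∀ a v i → deg (map (a *_) v) i ≡ a * deg v i
deg-map-* a []      i       = sym (ℕₚ.*-zeroʳ a)
deg-map-* a (x ∷ v) zero    = refl
deg-map-* a (x ∷ v) (suc i) = deg-map-* a v i

deg-padded-below : ∀ k v i → i < k → deg (replicate k 0 ++ v) i ≡ 0
deg-padded-below (suc k) v zero    _         = refl
deg-padded-below (suc k) v (suc i) (s≤s i<k) = deg-padded-below k v i i<k

deg-padded-at : ∀ k v i → deg (replicate k 0 ++ v) (k + i) ≡ deg v i
deg-padded-at zero    v i = refl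
deg-padded-at (suc k) v i = deg-padded-at k v i

deg-applyMonFrom : ∀ y k a e i → deg (applyMonFrom y k (a ∷ e)) i ≡ a * deg (y k) i + deg (applyMonFrom y (suc k) e) i
deg-applyMonFrom y k a e i = trans (deg-addV (map (a *_) (y k)) _ i) (cong (_+ _) (deg-map-* a (y k) i))

idSub-below : ∀ k e i → i < k → deg (applyMonFrom idSub k e) i ≡ 0
idSub-below k []      i i<k = refl
idSub-below k (a ∷ e) i i<k
  rewrite deg-applyMonFrom idSub k a e i | deg-padded-below k [ 1 ] i i<k | idSub-below (suc k) e i (ℕₚ.m<n⇒m<1+n i<k) =
  trans (ℕₚ.+-identityʳ _) (ℕₚ.*-zeroʳ a)

idSub-at : ∀ k e i → deg (applyMonFrom idSub k e) (k + i) ≡ deg e i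
idSub-at k []      i       = refl
idSub-at k (a ∷ e) zero
  rewrite deg-applyMonFrom idSub k a e (k + 0) | deg-padded-at k [ 1 ] 0 | ℕₚ.+-identityʳ k | idSub-below (suc k) e k (ℕₚ.n<1+n k) =
  trans (ℕₚ.+-identityʳ _) (ℕₚ.*-identityʳ a)
idSub-at k (a ∷ e) (suc i)
  rewrite deg-applyMonFrom idSub k a e (k + suc i) | deg-padded-at k [ 1 ] (suc i) | ℕₚ.+-suc k i | idSub-at (suc k) e i =
  cong (_+ deg e i) (ℕₚ.*-zeroʳ a)

deg-applyMon-idSub : ∀ e i → deg (applyMon idSub e) i ≡ deg e i
deg-applyMon-idSub e i = idSub-at 0 e i

degPrev : List ℕ → ℕ → ℕ
degPrev e zero    = 0
degPrev e (suc i) = deg e i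

pairSub-below : ∀ c k e i → i < suc k → deg (applyMonFrom (pairSub c) (suc k) e) i ≡ 0
pairSub-below c k []      i i<1+k = refl
pairSub-below c k (a ∷ e) i i<1+k
  rewrite deg-applyMonFrom (pairSub c) (suc k) a e i | deg-padded-below (suc k) (c ∷ c ∷ []) i i<1+k
        | pairSub-below c (suc k) e i (ℕₚ.m<n⇒m<1+n i<1+k) =
  trans (ℕₚ.+-identityʳ _) (ℕₚ.*-zeroʳ a)

pairSub-at : ∀ c k e i → deg (applyMonFrom (pairSub c) (suc k) e) (suc k + i) ≡ c * (deg e i + degPrev e i)
pairSub-at c k []      zero    = sym (ℕₚ.*-zeroʳ c)
pairSub-at c k []      (suc i) = sym (ℕₚ.*-zeroʳ c)
pairSub-at c k (a ∷ e) zero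
  rewrite deg-applyMonFrom (pairSub c) (suc k) a e (suc k + 0) | deg-padded-at (suc k) (c ∷ c ∷ []) 0 | ℕₚ.+-identityʳ k
        | pairSub-below c (suc k) e (suc k) (ℕₚ.n<1+n (suc k)) =
  trans (ℕₚ.+-identityʳ _) (trans (ℕₚ.*-comm a c) (cong (c *_) (sym (ℕₚ.+-identityʳ a))))
pairSub-at c k (a ∷ e) (suc zero) = begin
  deg (applyMonFrom (pairSub c) (suc k) (a ∷ e)) (suc k + 1)
    ≡⟨ deg-applyMonFrom (pairSub c) (suc k) a e (suc k + 1) ⟩
  a * deg (pairSub c (suc k)) (suc k + 1) + deg (applyMonFrom (pairSub c) (suc (suc k)) e) (suc k + 1)
    ≡⟨ cong₂ (λ d n → a * d + deg (applyMonFrom (pairSub c) (suc (suc k)) e) n)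
             (deg-padded-at (suc k) (c ∷ c ∷ []) 1) (cong suc (trans (ℕₚ.+-comm k 1) (sym (ℕₚ.+-identityʳ (suc k))))) ⟩
  a * c + deg (applyMonFrom (pairSub c) (suc (suc k)) e) (suc (suc k) + 0)
    ≡⟨ cong (a * c +_) (pairSub-at c (suc k) e 0) ⟩
  a * c + c * (deg e 0 + 0)
    ≡⟨ ℕ-Solver.solve 3 (λ a c d → a :* c :+ c :* (d :+ con 0) := c :* (d :+ a)) refl a c (deg e 0) ⟩
  c * (deg e 0 + a) ∎
  where
  open ≡-Reasoning
  open ℕ-Solver
pairSub-at c k (a ∷ e) (suc (suc i))
  rewrite deg-applyMonFrom (pairSub c) (suc k) a e (suc k + suc (suc i)) | deg-padded-at (suc k) (c ∷ c ∷ []) (suc (suc i))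
        | ℕₚ.+-suc k (suc i) | pairSub-at c (suc k) e (suc i) | ℕₚ.*-zeroʳ a = refl

deg-applyMon-pairSub-0 : ∀ c e → deg (applyMon (pairSub c) e) 0 ≡ c * deg e 0
deg-applyMon-pairSub-0 c []      = sym (ℕₚ.*-zeroʳ c)
deg-applyMon-pairSub-0 c (a ∷ e) rewrite deg-applyMonFrom (pairSub c) 0 a e 0 | pairSub-below c 0 e 0 (s≤s z≤n) =
  trans (ℕₚ.+-identityʳ _) (ℕₚ.*-comm a c)

deg-applyMon-pairSub-suc : ∀ c a e i → deg (applyMon (pairSub c) (a ∷ e)) (suc i) ≡ c * (deg e i + degPrev e i)
deg-applyMon-pairSub-suc c a e i =
  trans (deg-applyMonFrom (pairSub c) 0 a e (suc i))
        (trans (cong (_+ deg (applyMonFrom (pairSub c) 1 e) (suc i)) (ℕₚ.*-zeroʳ a)) (pairSub-at c 0 e i))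

+-foldr : ∀ {A : Set} (g : A → ℕ) xs → ℤ.+ foldr _+_ 0 (map g xs) ≡ ∑[ x ∈ xs ] ℤ.+ g x
+-foldr g []       = refl
+-foldr g (x ∷ xs) = cong (ℤ._+_ (ℤ.+ g x)) (+-foldr g xs)

+-length-filter : ∀ {A : Set} {P : A → Set} (P? : ∀ x → Dec (P x)) xs →
                  ℤ.+ length (filter P? xs) ≡ ∑[ x ∈ xs ] (if does (P? x) then 1ℤ else 0ℤ)
+-length-filter P? []       = refl
+-length-filter P? (x ∷ xs) with does (P? x)
... | true  = cong (ℤ._+_ 1ℤ) (+-length-filter P? xs)
... | false = trans (+-length-filter P? xs) (sym (ℤₚ.+-identityˡ _))

∑-upTo-extend : ∀ {M N} (F : ℕ → ℤ) → (∀ n → M ≤ n → F n ≡ 0ℤ) → M ≤ N → ∑ (upTo N) F ≡ ∑ (upTo M) F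
∑-upTo-extend {N = zero}  F F≡0 z≤n = refl
∑-upTo-extend {N = suc N} F F≡0 M≤1+N with ℕₚ.m≤n⇒m<n∨m≡n M≤1+N
... | inj₂ refl   = refl
... | inj₁ M<1+N = trans (∑-upTo-suc N F)
  (trans (cong₂ ℤ._+_ (∑-upTo-extend F F≡0 (ℕₚ.≤-pred M<1+N)) (F≡0 N (ℕₚ.≤-pred M<1+N))) (ℤₚ.+-identityʳ _))

-- The hypothesis on y makes the truncation of the length sum in genSeries harmless.
genFamily : ∀ P y → (∀ π → length π ≤ deg (applyMon y (expVec π)) 0) →
            ∀ {Q : Tree → Set} → (∀ t → Reflects (Q t) (P (flatten t))) → GeneratingFamily (genSeries P y)
genFamily P y y-deg {Q} Q-reflects = record
  { Index  = Tree
  ; family = λ H → filter Q? (trees≤ H)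
  ; weight = W ∘ flatten
  ; coeff  = coeff-eq
  }
  where
  Q? : ∀ t → Dec (Q t)
  Q? t = P (flatten t) because Q-reflects t
  W : List ℕ → List ℕ
  W π = applyMon y (expVec π)
  term : List ℕ → List ℕ → ℤ
  term m π = if P π then mono (W π) m else 0ℤ
  count : ∀ m n → ℤ.+ countLen P y m n ≡ ∑[ π ∈ filter avoids132? (perms n) ] term m π
  count m n = begin
    ℤ.+ countLen P y m n
      ≡⟨ +-length-filter (λ π → T? (avoids132 π ∧ P π ∧ sameMon (W π) m)) (perms n) ⟩
    ∑[ π ∈ perms n ] (if avoids132 π ∧ P π ∧ sameMon (W π) m then 1ℤ else 0ℤ)
      ≡⟨ ∑-cong (perms n) (λ π → if-∧ (avoids132 π) (P π) (sameMon (W π) m)) ⟩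
    ∑[ π ∈ perms n ] (if avoids132 π then term m π else 0ℤ)
      ≡⟨ sym (∑-filter avoids132? (perms n) (term m)) ⟩
    ∑[ π ∈ filter avoids132? (perms n) ] term m π ∎
    where
    open ≡-Reasoning
    if-∧ : ∀ a p s → (if a ∧ p ∧ s then 1ℤ else 0ℤ) ≡ (if a then (if p then (if s then 1ℤ else 0ℤ) else 0ℤ) else 0ℤ)
    if-∧ true  true  s = refl
    if-∧ true  false s = refl
    if-∧ false p     s = refl
  vanish : ∀ m n → suc (head0 m) ≤ n → ℤ.+ countLen P y m n ≡ 0ℤ
  vanish m n m<n = trans (count m n) (trans (∑-cong-∈ _ term≡0) (∑-0 (filter avoids132? (perms n))))
    where
    term≡0 : ∀ π → π ∈ filter avoids132? (perms n) → term m π ≡ 0ℤ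
    term≡0 π π∈ with P π
    ... | false = refl
    ... | true  = mono-≉ {W π} {m} λ Wπ≈m → ℕₚ.<⇒≱ m<n (begin
      n                       ≡⟨ sym (proj₁ (∈-perms⁻ n π (proj₁ (∈-filter⁻ avoids132? {xs = perms n} π∈)))) ⟩
      length π                ≤⟨ y-deg π ⟩
      deg (W π) 0             ≡⟨ Wπ≈m 0 ⟩
      deg m 0                 ≡⟨ sym (head0≡deg0 m) ⟩
      head0 m                 ∎)
      where open ℕₚ.≤-Reasoning
  coeff-eq : ∀ H m → head0 m ≤ H → genSeries P y m ≡ ∑[ t ∈ filter Q? (trees≤ H) ] mono (W (flatten t)) m
  coeff-eq H m m≤H = begin
    genSeries P y m
      ≡⟨ +-foldr (countLen P y m) (upTo (suc (head0 m))) ⟩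
    ∑[ n ∈ upTo (suc (head0 m)) ] ℤ.+ countLen P y m n
      ≡⟨ sym (∑-upTo-extend (λ n → ℤ.+ countLen P y m n) (vanish m) (s≤s m≤H)) ⟩
    ∑[ n ∈ upTo (suc H) ] ℤ.+ countLen P y m n
      ≡⟨ ∑-cong (upTo (suc H)) (count m) ⟩
    ∑[ n ∈ upTo (suc H) ] ∑[ π ∈ filter avoids132? (perms n) ] term m π
      ≡⟨ sym (∑-concatMap (λ n → filter avoids132? (perms n)) (upTo (suc H)) (term m)) ⟩
    ∑ (avoiders≤ H) (term m)
      ≡⟨ ∑-avoiders≤ H (term m) ⟩
    ∑[ t ∈ trees≤ H ] term m (flatten t)
      ≡⟨ sym (∑-filter Q? (trees≤ H) (λ t → mono (W (flatten t)) m)) ⟩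
    ∑[ t ∈ filter Q? (trees≤ H) ] mono (W (flatten t)) m ∎
    where open ≡-Reasoning

-- Decomposition of self-inverse trees

selfInverse? : (t : Tree) → Dec (t ≡ inv t)
selfInverse? t = isInvolution (flatten t) because isInvolution-reflects t

involutions≤ : ℕ → List Tree
involutions≤ H = filter selfInverse? (trees≤ H)

-- The involution whose first block is flatten a: its last block ends with the inverse of flatten a
-- followed by size a, and g describes what lies in between.
bracket : Tree → Tree → Tree
bracket a g = node a (graft g (node (inv a) leaf))

size-<-graft-node : ∀ g₁ g₂ x → size x < size (graft (node g₁ g₂) x)
size-<-graft-node g₁ g₂ x =
  s≤s (ℕₚ.≤-trans (subst (size x ≤_) (sym (size-graft g₂ x)) (ℕₚ.m≤n+m (size x) (size g₂))) (ℕₚ.m≤n+m _ (size g₁)))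

graft-cancelʳ : ∀ g g′ x → graft g x ≡ graft g′ x → g ≡ g′
graft-cancelʳ leaf         leaf         x eq = refl
graft-cancelʳ leaf         (node g₁ g₂) x eq = ⊥-elim (ℕₚ.<-irrefl (cong size eq) (size-<-graft-node g₁ g₂ x))
graft-cancelʳ (node g₁ g₂) leaf         x eq = ⊥-elim (ℕₚ.<-irrefl (cong size (sym eq)) (size-<-graft-node g₁ g₂ x))
graft-cancelʳ (node g₁ g₂) (node h₁ h₂) x eq with refl , eq′ ← node-injective eq =
  cong (node g₁) (graft-cancelʳ g₂ h₂ x eq′)

bracket-injective : ∀ {a g a′ g′} → bracket a g ≡ bracket a′ g′ → a ≡ a′ × g ≡ g′
bracket-injective {g = g} {g′ = g′} eq with refl , eq′ ← node-injective eq = refl , graft-cancelʳ g g′ _ eq′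

node-leaf≢bracket : ∀ α a g → node α leaf ≢ bracket a g
node-leaf≢bracket α a g eq = graft-node≢leaf g (inv a) leaf (sym (proj₂ (node-injective eq)))

bracket-selfInverse : ∀ a g → g ≡ inv g → bracket a g ≡ inv (bracket a g)
bracket-selfInverse a g g≡g⁻¹ = sym (begin
  graft (inv (graft g (node (inv a) leaf))) (node (inv a) leaf)        ≡⟨ cong (λ t → graft t (node (inv a) leaf)) (inv-graft g _) ⟩
  graft (graft (node (inv (inv a)) leaf) (inv g)) (node (inv a) leaf)  ≡⟨ cong₂ (λ u v → graft (graft (node u leaf) v) (node (inv a) leaf))
                                                                                (inv-involutive a) (sym g≡g⁻¹) ⟩
  bracket a g                                                          ∎)
  where open ≡-Reasoning

selfInverse-node : ∀ l r → node l r ≡ inv (node l r) →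
                   (r ≡ leaf × l ≡ inv l) ⊎ ∃[ g ] r ≡ graft g (node (inv l) leaf) × g ≡ inv g
selfInverse-node l leaf         eq = inj₁ (refl , proj₁ (node-injective eq))
selfInverse-node l (node r₁ r₂) eq with inv (node r₁ r₂) in r⁻¹≡
... | leaf      = ⊥-elim (graft-node≢leaf (inv r₂) (inv r₁) leaf r⁻¹≡)
... | node u₁ u₂ with refl , r≡ ← node-injective eq =
  inj₂ (u₂ , r≡ , proj₂ (node-injective (trans (sym r⁻¹≡) r⁻¹≡′)))
  where
  r⁻¹≡′ : inv (node r₁ r₂) ≡ node l (inv u₂)
  r⁻¹≡′ = begin
    inv (node r₁ r₂)                         ≡⟨ cong inv r≡ ⟩
    inv (graft u₂ (node (inv l) leaf))       ≡⟨ inv-graft u₂ _ ⟩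
    graft (node (inv (inv l)) leaf) (inv u₂) ≡⟨ cong (λ t → node t (inv u₂)) (inv-involutive l) ⟩
    node l (inv u₂)                          ∎
    where open ≡-Reasoning

∈-involutions≤⁺ : ∀ H {t} → size t ≤ H → t ≡ inv t → t ∈ involutions≤ H
∈-involutions≤⁺ H {t} |t|≤H t≡t⁻¹ = ∈-filter⁺ selfInverse? (∈-trees≤⁺ H t |t|≤H) t≡t⁻¹

∈-involutions≤⁻ : ∀ H {t} → t ∈ involutions≤ H → size t ≤ H × t ≡ inv t
∈-involutions≤⁻ H t∈ with t∈trees , t≡t⁻¹ ← ∈-filter⁻ selfInverse? {xs = trees≤ H} t∈ =
  ∈-trees≤⁻ H t∈trees , t≡t⁻¹

module _ (H : ℕ) where

  private
    fits : ∀ t → Dec (size t ≤ H)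
    fits t = size t ≤? H
    stems : List Tree
    stems = map (λ α → node α leaf) (filter (λ α → fits (node α leaf)) (involutions≤ H))
    brackets : Tree → List Tree
    brackets a = map (bracket a) (filter (fits ∘ bracket a) (involutions≤ H))

  -- involutions≤ H, listed through the decomposition of self-inverse trees
  decomposed≤ : List Tree
  decomposed≤ = leaf ∷ (stems ++ concatMap brackets (trees≤ H))

  private
    ∈-stems⁻ : ∀ {t} → t ∈ stems → ∃[ α ] t ≡ node α leaf × α ∈ filter (λ α → fits (node α leaf)) (involutions≤ H)
    ∈-stems⁻ t∈ with α , α∈ , refl ← ∈-map⁻ (λ α → node α leaf) t∈ = α , refl , α∈
    ∈-brackets⁻ : ∀ {t} → t ∈ concatMap brackets (trees≤ H) →
                  ∃[ a ] ∃[ g ] t ≡ bracket a g × g ∈ filter (fits ∘ bracket a) (involutions≤ H)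
    ∈-brackets⁻ t∈ with a , _ , t∈a ← find (∈-concatMap⁻ brackets {xs = trees≤ H} t∈)
                   with g , g∈ , refl ← ∈-map⁻ (bracket a) t∈a = a , g , refl , g∈

  Unique-decomposed≤ : Unique decomposed≤
  Unique-decomposed≤ = All.¬Any⇒All¬ (stems ++ concatMap brackets (trees≤ H)) leaf∉ ∷ Unique.++⁺ stems! brackets! disjoint
    where
    leaf∉ : leaf ∉ stems ++ concatMap brackets (trees≤ H)
    leaf∉ leaf∈ with ∈-++⁻ stems leaf∈
    ... | inj₁ ∈stems with _ , () , _ ← ∈-stems⁻ ∈stems
    ... | inj₂ ∈brackets with _ , _ , () , _ ← ∈-brackets⁻ ∈brackets
    stems! : Unique stems
    stems! = Unique.map⁺ (proj₁ ∘ node-injective)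
                         (Unique.filter⁺ (λ α → fits (node α leaf)) (Unique.filter⁺ selfInverse? (Unique-trees≤ H)))
    brackets! : Unique (concatMap brackets (trees≤ H))
    brackets! = Unique-concatMap brackets (Unique-trees≤ H)
      (λ {a} _ → Unique.map⁺ (proj₂ ∘ bracket-injective)
                             (Unique.filter⁺ (fits ∘ bracket a) (Unique.filter⁺ selfInverse? (Unique-trees≤ H))))
      (λ _ _ t∈a t∈a′ → same-a t∈a t∈a′)
      where
      same-a : ∀ {a a′ t} → t ∈ brackets a → t ∈ brackets a′ → a ≡ a′
      same-a {a} {a′} t∈a t∈a′ with _ , _ , refl ← ∈-map⁻ (bracket a) t∈a | _ , _ , eq ← ∈-map⁻ (bracket a′) t∈a′ =
        proj₁ (bracket-injective eq)
    disjoint : ∀ {t} → ¬ (t ∈ stems × t ∈ concatMap brackets (trees≤ H))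
    disjoint (t∈s , t∈b) with α , refl , _ ← ∈-stems⁻ t∈s | a , g , eq , _ ← ∈-brackets⁻ t∈b =
      node-leaf≢bracket α a g eq

  decomposed≤⊆involutions≤ : ∀ {t} → t ∈ decomposed≤ → t ∈ involutions≤ H
  decomposed≤⊆involutions≤ (here refl) = ∈-involutions≤⁺ H z≤n refl
  decomposed≤⊆involutions≤ (there t∈) with ∈-++⁻ stems t∈
  ... | inj₁ ∈stems with α , refl , α∈ ← ∈-stems⁻ ∈stems
    with α∈IT , fits-α ← ∈-filter⁻ (λ α → fits (node α leaf)) {xs = involutions≤ H} α∈ =
      ∈-involutions≤⁺ H fits-α (cong (λ t → node t leaf) (proj₂ (∈-involutions≤⁻ H α∈IT)))
  ... | inj₂ ∈brackets with a , g , refl , g∈ ← ∈-brackets⁻ ∈brackets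
    with g∈IT , fits-ag ← ∈-filter⁻ (fits ∘ bracket a) {xs = involutions≤ H} g∈ =
      ∈-involutions≤⁺ H fits-ag (bracket-selfInverse a g (proj₂ (∈-involutions≤⁻ H g∈IT)))

  involutions≤⊆decomposed≤ : ∀ {t} → t ∈ involutions≤ H → t ∈ decomposed≤
  involutions≤⊆decomposed≤ {leaf}     _  = here refl
  involutions≤⊆decomposed≤ {node l r} t∈ with |t|≤H , t≡t⁻¹ ← ∈-involutions≤⁻ H t∈ with selfInverse-node l r t≡t⁻¹
  ... | inj₁ (refl , l≡l⁻¹) =
    there (∈-++⁺ˡ (∈-map⁺ (λ α → node α leaf) (∈-filter⁺ (λ α → fits (node α leaf))
      (∈-involutions≤⁺ H (ℕₚ.≤-trans (ℕₚ.≤-trans (ℕₚ.m≤m+n (size l) 0) (ℕₚ.n≤1+n _)) |t|≤H) l≡l⁻¹) |t|≤H)))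
  ... | inj₂ (g , refl , g≡g⁻¹) =
    there (∈-++⁺ʳ stems (∈-concatMap⁺ brackets {xs = trees≤ H} (lose (∈-trees≤⁺ H l |l|≤H)
      (∈-map⁺ (bracket l) (∈-filter⁺ (fits ∘ bracket l) (∈-involutions≤⁺ H |g|≤H g≡g⁻¹) |t|≤H)))))
    where
    |r|≤H : size (graft g (node (inv l) leaf)) ≤ H
    |r|≤H = ℕₚ.≤-trans (ℕₚ.≤-trans (ℕₚ.m≤n+m _ (size l)) (ℕₚ.n≤1+n _)) |t|≤H
    |l|≤H : size l ≤ H
    |l|≤H = ℕₚ.≤-trans (ℕₚ.≤-trans (ℕₚ.m≤m+n (size l) _) (ℕₚ.n≤1+n _)) |t|≤H
    |g|≤H : size g ≤ H
    |g|≤H = ℕₚ.≤-trans (subst (size g ≤_) (sym (size-graft g _)) (ℕₚ.m≤m+n (size g) _)) |r|≤H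

  ∑-involutions≤ : ∀ (h : Tree → ℤ) → (∀ t → H < size t → h t ≡ 0ℤ) →
                   ∑ (involutions≤ H) h ≡ h leaf ℤ.+ ((∑[ α ∈ involutions≤ H ] h (node α leaf))
                                                    ℤ.+ (∑[ a ∈ trees≤ H ] ∑[ g ∈ involutions≤ H ] h (bracket a g)))
  ∑-involutions≤ h h-vanishes = begin
    ∑ (involutions≤ H) h
      ≡⟨ ∑-bijection id id (Unique-decomposed≤) (Unique.filter⁺ selfInverse? (Unique-trees≤ H))
                     decomposed≤⊆involutions≤ (λ t∈ → _ , involutions≤⊆decomposed≤ t∈ , refl) h ⟩
    h leaf ℤ.+ ∑ (stems ++ concatMap brackets (trees≤ H)) h
      ≡⟨ cong (ℤ._+_ (h leaf)) (trans (∑-++ stems _ h) (cong₂ ℤ._+_ ∑-stems ∑-brackets)) ⟩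
    h leaf ℤ.+ ((∑[ α ∈ involutions≤ H ] h (node α leaf))
                ℤ.+ (∑[ a ∈ trees≤ H ] ∑[ g ∈ involutions≤ H ] h (bracket a g))) ∎
    where
    open ≡-Reasoning
    drop-fits : ∀ t → (if does (fits t) then h t else 0ℤ) ≡ h t
    drop-fits t with size t ℕ.≤ᵇ H | ℕₚ.≤ᵇ-reflects-≤ (size t) H
    ... | true  | _          = refl
    ... | false | ofⁿ |t|≰H = sym (h-vanishes t (ℕₚ.≰⇒> |t|≰H))
    ∑-fits : ∀ (k : Tree → Tree) → ∑ (map k (filter (fits ∘ k) (involutions≤ H))) h ≡ ∑[ g ∈ involutions≤ H ] h (k g)
    ∑-fits k = trans (∑-map k (filter (fits ∘ k) (involutions≤ H)) h)
                     (trans (∑-filter (fits ∘ k) (involutions≤ H) (h ∘ k)) (∑-cong (involutions≤ H) (drop-fits ∘ k)))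
    ∑-stems = ∑-fits (λ α → node α leaf)
    ∑-brackets = trans (∑-concatMap brackets (trees≤ H) h) (∑-cong (trees≤ H) (∑-fits ∘ bracket))

wI : Tree → List ℕ
wI t = applyMon idSub (expVec (flatten t))

wPair : ℕ → Tree → List ℕ
wPair c t = applyMon (pairSub c) (expVec (flatten t))

occPrev : Tree → ℕ → ℕ
occPrev t zero    = 0
occPrev t (suc i) = occ i t

deg-wI : ∀ t i → deg (wI t) i ≡ treeDeg t i
deg-wI t i = trans (deg-applyMon-idSub (expVec (flatten t)) i) (deg-expVec-flatten t i)

deg-wPair-0 : ∀ c t → deg (wPair c t) 0 ≡ c * size t
deg-wPair-0 c t = trans (deg-applyMon-pairSub-0 c (expVec (flatten t))) (cong (c *_) (length-flatten t))

deg-wPair-suc : ∀ c t i → deg (wPair c t) (suc i) ≡ c * (occ i t + occPrev t i)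
deg-wPair-suc c t i =
  trans (deg-applyMon-pairSub-suc c (length (flatten t)) _ i) (cong (c *_) (cong₂ _+_ (deg-expVec-flatten t (suc i)) (prev i)))
  where
  prev : ∀ i → degPrev (map (λ j → pat (2 + j) (flatten t)) (upTo (length (flatten t) ∸ 1))) i ≡ occPrev t i
  prev zero    = refl
  prev (suc i) = deg-expVec-flatten t (suc i)

wI-leaf : wI leaf ≈ᵐ []
wI-leaf zero    = refl
wI-leaf (suc i) = refl

wI-stem-leaf : wI (node leaf leaf) ≈ᵐ 1 ∷ []
wI-stem-leaf zero          = deg-wI (node leaf leaf) 0
wI-stem-leaf (suc zero)    = deg-wI (node leaf leaf) 1
wI-stem-leaf (suc (suc j)) = deg-wI (node leaf leaf) (suc (suc j))

wI-stem : ∀ α → nonLeaf α ≡ 1 → wI (node α leaf) ≈ᵐ addV (1 ∷ 1 ∷ []) (wPair 1 α)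
wI-stem α α≢leaf zero
  rewrite deg-wI (node α leaf) 0 | deg-addV (1 ∷ 1 ∷ []) (wPair 1 α) 0 | deg-wPair-0 1 α =
  cong suc (trans (ℕₚ.+-identityʳ (size α)) (sym (ℕₚ.+-identityʳ (size α))))
wI-stem α α≢leaf (suc zero)
  rewrite deg-wI (node α leaf) 1 | deg-addV (1 ∷ 1 ∷ []) (wPair 1 α) 1 | deg-wPair-suc 1 α 0 | α≢leaf =
  ℕ-Solver.solve 1 (λ p → (p :+ con 1) :+ con 0 := con 1 :+ ((p :+ con 0) :+ con 0)) refl (occ 0 α)
  where open ℕ-Solver
wI-stem α α≢leaf (suc (suc j))
  rewrite deg-wI (node α leaf) (suc (suc j)) | deg-addV (1 ∷ 1 ∷ []) (wPair 1 α) (suc (suc j)) | deg-wPair-suc 1 α (suc j) =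
  ℕ-Solver.solve 2 (λ p q → (p :+ q) :+ con 0 := con 0 :+ ((p :+ q) :+ con 0)) refl (occ (suc j) α) (occ j α)
  where open ℕ-Solver

wI-bracket-leaf : ∀ g → wI (bracket leaf g) ≈ᵐ addV (2 ∷ []) (wI g)
wI-bracket-leaf g zero
  rewrite deg-wI (bracket leaf g) 0 | deg-addV (2 ∷ []) (wI g) 0 | deg-wI g 0 | size-graft g (node leaf leaf) =
  cong suc (ℕₚ.+-comm (size g) 1)
wI-bracket-leaf g (suc zero)
  rewrite deg-wI (bracket leaf g) 1 | deg-addV (2 ∷ []) (wI g) 1 | deg-wI g 1 | occ-graft 0 g (node leaf leaf) =
  ℕₚ.+-identityʳ (occ 0 g)
wI-bracket-leaf g (suc (suc j))
  rewrite deg-wI (bracket leaf g) (suc (suc j)) | deg-addV (2 ∷ []) (wI g) (suc (suc j)) | deg-wI g (suc (suc j))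
        | occ-graft (suc j) g (node leaf leaf) =
  ℕₚ.+-identityʳ (occ (suc j) g)

wI-bracket : ∀ a g → nonLeaf a ≡ 1 → wI (bracket a g) ≈ᵐ addV (addV (2 ∷ 2 ∷ []) (wPair 2 a)) (wI g)
wI-bracket a g a≢leaf zero
  rewrite deg-wI (bracket a g) 0 | deg-addV (addV (2 ∷ 2 ∷ []) (wPair 2 a)) (wI g) 0 | deg-addV (2 ∷ 2 ∷ []) (wPair 2 a) 0
        | deg-wPair-0 2 a | deg-wI g 0 | size-graft g (node (inv a) leaf) | size-inv a =
  ℕ-Solver.solve 2 (λ a g → con 1 :+ (a :+ (g :+ (con 1 :+ (a :+ con 0)))) := (con 2 :+ con 2 :* a) :+ g) refl (size a) (size g)
  where open ℕ-Solver
wI-bracket a g a≢leaf (suc zero)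
  rewrite deg-wI (bracket a g) 1 | deg-addV (addV (2 ∷ 2 ∷ []) (wPair 2 a)) (wI g) 1 | deg-addV (2 ∷ 2 ∷ []) (wPair 2 a) 1
        | deg-wPair-suc 2 a 0 | deg-wI g 1 | occ-graft 0 g (node (inv a) leaf) | occMax-inv 0 a | a≢leaf =
  ℕ-Solver.solve 2 (λ p q → (p :+ con 1) :+ (q :+ ((p :+ con 1) :+ con 0)) := (con 2 :+ con 2 :* (p :+ con 0)) :+ q)
                 refl (occ 0 a) (occ 0 g)
  where open ℕ-Solver
wI-bracket a g a≢leaf (suc (suc j))
  rewrite deg-wI (bracket a g) (suc (suc j)) | deg-addV (addV (2 ∷ 2 ∷ []) (wPair 2 a)) (wI g) (suc (suc j))
        | deg-addV (2 ∷ 2 ∷ []) (wPair 2 a) (suc (suc j)) | deg-wPair-suc 2 a (suc j) | deg-wI g (suc (suc j))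
        | occ-graft (suc j) g (node (inv a) leaf) | occMax-inv (suc j) a =
  ℕ-Solver.solve 3 (λ p q r → (p :+ q) :+ (r :+ ((p :+ q) :+ con 0)) := (con 0 :+ con 2 :* (p :+ q)) :+ r)
                 refl (occ (suc j) a) (occ j a) (occ (suc j) g)
  where open ℕ-Solver

x₁x₁≋ : X 0 ⊛ X 0 ≋ mono (2 ∷ [])
x₁x₁≋ = mono-⊛ (1 ∷ []) (1 ∷ [])

x₁x₂≋ : X 0 ⊛ X 1 ≋ mono (1 ∷ 1 ∷ [])
x₁x₂≋ = mono-⊛ (1 ∷ []) (0 ∷ 1 ∷ [])

x₁x₁x₂x₂≋ : X 0 ⊛ X 0 ⊛ X 1 ⊛ X 1 ≋ mono (2 ∷ 2 ∷ [])
x₁x₁x₂x₂≋ m = begin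
  (X 0 ⊛ X 0 ⊛ X 1 ⊛ X 1) m         ≡⟨ ⊛-congʳ (X 1) (λ m′ → trans (⊛-congʳ (X 1) x₁x₁≋ m′)
                                                                  (mono-⊛ (2 ∷ []) (0 ∷ 1 ∷ []) m′)) m ⟩
  (mono (2 ∷ 1 ∷ []) ⊛ X 1) m       ≡⟨ mono-⊛ (2 ∷ 1 ∷ []) (0 ∷ 1 ∷ []) m ⟩
  mono (2 ∷ 2 ∷ []) m               ∎
  where open ≡-Reasoning

idSub-deg : ∀ π → length π ≤ deg (applyMon idSub (expVec π)) 0
idSub-deg π = ℕₚ.≤-reflexive (sym (deg-applyMon-idSub (expVec π) 0))

pairSub-deg : ∀ c .{{_ : ℕ.NonZero c}} π → length π ≤ deg (applyMon (pairSub c) (expVec π)) 0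
pairSub-deg c π = subst (length π ≤_) (sym (deg-applyMon-pairSub-0 c (expVec π))) (ℕₚ.m≤n*m (length π) c)

DI-family : ∀ y → (∀ π → length π ≤ deg (applyMon y (expVec π)) 0) → GeneratingFamily (DI y)
DI-family y y-deg = genFamily isInvolution y y-deg isInvolution-reflects

DS-family : ∀ y → (∀ π → length π ≤ deg (applyMon y (expVec π)) 0) → GeneratingFamily (DS y)
DS-family y y-deg = genFamily (λ _ → true) y y-deg (λ _ → ofʸ tt)

ℤ-rearrange : ∀ {A B C D E A₁ A₂ c₀ c₁ c₁₁ : ℤ} →
              A ≡ c₀ ℤ.+ (A₁ ℤ.+ A₂) → A₁ ℤ.+ c₁₁ ≡ c₁ ℤ.+ E → A₂ ℤ.+ C ≡ B ℤ.+ D →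
              A ℤ.- B ℤ.+ C ℤ.- D ≡ c₀ ℤ.+ c₁ ℤ.- c₁₁ ℤ.+ E
ℤ-rearrange {A} {B} {C} {D} {E} {A₁} {A₂} {c₀} {c₁} {c₁₁} refl A₁-eq A₂-eq = begin
  c₀ ℤ.+ (A₁ ℤ.+ A₂) ℤ.- B ℤ.+ C ℤ.- D
    ≡⟨ solve 7 (λ c₀ a₁ a₂ b c d c₁₁ →
                  c₀ :+ (a₁ :+ a₂) :- b :+ c :- d := c₀ :+ (a₁ :+ c₁₁) :- c₁₁ :+ (a₂ :+ c :- b :- d))
             refl c₀ A₁ A₂ B C D c₁₁ ⟩
  c₀ ℤ.+ (A₁ ℤ.+ c₁₁) ℤ.- c₁₁ ℤ.+ (A₂ ℤ.+ C ℤ.- B ℤ.- D)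
    ≡⟨ cong₂ (λ u v → c₀ ℤ.+ u ℤ.- c₁₁ ℤ.+ (v ℤ.- B ℤ.- D)) A₁-eq A₂-eq ⟩
  c₀ ℤ.+ (c₁ ℤ.+ E) ℤ.- c₁₁ ℤ.+ (B ℤ.+ D ℤ.- B ℤ.- D)
    ≡⟨ solve 6 (λ c₀ c₁ e c₁₁ b d → c₀ :+ (c₁ :+ e) :- c₁₁ :+ (b :+ d :- b :- d) := c₀ :+ c₁ :- c₁₁ :+ e)
             refl c₀ c₁ E c₁₁ B D ⟩
  c₀ ℤ.+ c₁ ℤ.- c₁₁ ℤ.+ E ∎
  where
  open ≡-Reasoning
  open ℤ-Solver

-- The coefficients of x^m in x^e D_I, in x₁²x₂² D_I D_S(x₁², x₂²x₃², …) and in x₁x₂ D_I(x₁, x₂x₃, …),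
-- as sums over self-inverse trees.
module Coefficients (m : List ℕ) where

  H = head0 m
  I = involutions≤ H

  c : List ℕ → ℤ
  c e = mono e m

  xᵉDI : List ℕ → ℤ
  xᵉDI e = ∑[ t ∈ I ] c (addV (wI t) e)

  x₁²x₂²DIDS : ℤ
  x₁²x₂²DIDS = ∑[ t ∈ I ] ∑[ s ∈ trees≤ H ] c (addV (wI t) (addV (2 ∷ 2 ∷ []) (wPair 2 s)))

  x₁x₂DI : ℤ
  x₁x₂DI = ∑[ t ∈ I ] c (addV (1 ∷ 1 ∷ []) (wPair 1 t))

  stems brackets : ℤ
  stems    = ∑[ α ∈ I ] c (wI (node α leaf))
  brackets = ∑[ a ∈ trees≤ H ] ∑[ g ∈ I ] c (wI (bracket a g))

  DI-decomposition : xᵉDI [] ≡ c [] ℤ.+ (stems ℤ.+ brackets)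
  DI-decomposition = begin
    ∑[ t ∈ I ] c (addV (wI t) [])          ≡⟨ ∑-cong I (λ t → cong c (addV-identityʳ (wI t))) ⟩
    ∑[ t ∈ I ] c (wI t)                    ≡⟨ ∑-involutions≤ H (c ∘ wI) vanish ⟩
    c (wI leaf) ℤ.+ (stems ℤ.+ brackets)   ≡⟨ cong (ℤ._+ (stems ℤ.+ brackets)) (mono-resp-≈ᵐ {wI leaf} {[]} m wI-leaf) ⟩
    c [] ℤ.+ (stems ℤ.+ brackets)          ∎
    where
    open ℕₚ.≤-Reasoning using () renaming (begin_ to begin≤_; _∎ to _∎≤)
    open ≡-Reasoning
    vanish : ∀ t → H < size t → c (wI t) ≡ 0ℤ
    vanish t H<t = mono-≉ {wI t} {m} λ wI≈m → ℕₚ.<⇒≢ H<t (trans (head0≡deg0 m) (sym (trans (sym (deg-wI t 0)) (wI≈m 0))))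

  stems-identity : stems ℤ.+ c (1 ∷ 1 ∷ []) ≡ c (1 ∷ []) ℤ.+ x₁x₂DI
  stems-identity = begin
    (c (wI (node leaf leaf)) ℤ.+ rest) ℤ.+ c (1 ∷ 1 ∷ [])
      ≡⟨ cong (λ z → (z ℤ.+ rest) ℤ.+ c (1 ∷ 1 ∷ [])) (mono-resp-≈ᵐ {wI (node leaf leaf)} {1 ∷ []} m wI-stem-leaf) ⟩
    (c (1 ∷ []) ℤ.+ rest) ℤ.+ c (1 ∷ 1 ∷ [])
      ≡⟨ ℤₚ.+-assoc (c (1 ∷ [])) rest _ ⟩
    c (1 ∷ []) ℤ.+ (rest ℤ.+ c (1 ∷ 1 ∷ []))
      ≡⟨ cong (ℤ._+_ (c (1 ∷ []))) (trans (ℤₚ.+-comm rest _) (cong (ℤ._+_ (c (1 ∷ 1 ∷ []))) rest≡)) ⟩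
    c (1 ∷ []) ℤ.+ x₁x₂DI ∎
    where
    open ≡-Reasoning
    I⁺ = filter selfInverse? (nodes≤ H)
    rest = ∑[ α ∈ I⁺ ] c (wI (node α leaf))
    rest≡ : rest ≡ ∑[ α ∈ I⁺ ] c (addV (1 ∷ 1 ∷ []) (wPair 1 α))
    rest≡ = ∑-cong-∈ I⁺ stem
      where
      stem : ∀ α → α ∈ I⁺ → c (wI (node α leaf)) ≡ c (addV (1 ∷ 1 ∷ []) (wPair 1 α))
      stem α α∈ = mono-resp-≈ᵐ {wI (node α leaf)} {addV (1 ∷ 1 ∷ []) (wPair 1 α)} m
                    (wI-stem α (∈-nodes≤⇒nonLeaf H (proj₁ (∈-filter⁻ selfInverse? {xs = nodes≤ H} α∈))))

  brackets-identity : brackets ℤ.+ xᵉDI (2 ∷ 2 ∷ []) ≡ xᵉDI (2 ∷ []) ℤ.+ x₁²x₂²DIDS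
  brackets-identity = begin
    brackets ℤ.+ xᵉDI (2 ∷ 2 ∷ [])
      ≡⟨ cong (ℤ._+ xᵉDI (2 ∷ 2 ∷ [])) (cong₂ ℤ._+_ leaf-brackets node-brackets) ⟩
    (xᵉDI (2 ∷ []) ℤ.+ cross) ℤ.+ xᵉDI (2 ∷ 2 ∷ [])
      ≡⟨ ℤₚ.+-assoc (xᵉDI (2 ∷ [])) cross _ ⟩
    xᵉDI (2 ∷ []) ℤ.+ (cross ℤ.+ xᵉDI (2 ∷ 2 ∷ []))
      ≡⟨ cong (ℤ._+_ (xᵉDI (2 ∷ []))) (trans (ℤₚ.+-comm cross _) (sym DIDS≡)) ⟩
    xᵉDI (2 ∷ []) ℤ.+ x₁²x₂²DIDS ∎
    where
    open ≡-Reasoning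
    cross = ∑[ a ∈ nodes≤ H ] ∑[ t ∈ I ] c (addV (wI t) (addV (2 ∷ 2 ∷ []) (wPair 2 a)))
    leaf-bracket : ∀ g → c (wI (bracket leaf g)) ≡ c (addV (wI g) (2 ∷ []))
    leaf-bracket g = trans (mono-resp-≈ᵐ {wI (bracket leaf g)} {addV (2 ∷ []) (wI g)} m (wI-bracket-leaf g))
                           (mono-addV-comm (2 ∷ []) (wI g) m)
    node-bracket : ∀ a → a ∈ nodes≤ H → ∀ g → c (wI (bracket a g)) ≡ c (addV (wI g) (addV (2 ∷ 2 ∷ []) (wPair 2 a)))
    node-bracket a a∈ g = trans (mono-resp-≈ᵐ {wI (bracket a g)} {addV (addV (2 ∷ 2 ∷ []) (wPair 2 a)) (wI g)} m
                                              (wI-bracket a g (∈-nodes≤⇒nonLeaf H a∈)))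
                                (mono-addV-comm (addV (2 ∷ 2 ∷ []) (wPair 2 a)) (wI g) m)
    leaf-brackets : ∑[ g ∈ I ] c (wI (bracket leaf g)) ≡ xᵉDI (2 ∷ [])
    leaf-brackets = ∑-cong I leaf-bracket
    node-brackets : ∑[ a ∈ nodes≤ H ] ∑[ g ∈ I ] c (wI (bracket a g)) ≡ cross
    node-brackets = ∑-cong-∈ (nodes≤ H) λ a a∈ → ∑-cong I (node-bracket a a∈)
    DIDS≡ : x₁²x₂²DIDS ≡ xᵉDI (2 ∷ 2 ∷ []) ℤ.+ cross
    DIDS≡ = trans (∑-+ I (λ t → c (addV (wI t) (2 ∷ 2 ∷ []))) (λ t → ∑[ a ∈ nodes≤ H ] F t a))
                  (cong (ℤ._+_ (xᵉDI (2 ∷ 2 ∷ []))) (∑-swap I (nodes≤ H) F))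
      where
      F : Tree → Tree → ℤ
      F t a = c (addV (wI t) (addV (2 ∷ 2 ∷ []) (wPair 2 a)))

  private
    DIᶠ = DI-family idSub idSub-deg
    x₁x₁ = X 0 ⊛ X 0
    x₁x₁x₂x₂ = X 0 ⊛ X 0 ⊛ X 1 ⊛ X 1

  DI⊛x₁x₁ : (DI idSub ⊛ x₁x₁) m ≡ xᵉDI (2 ∷ [])
  DI⊛x₁x₁ = trans (⊛-congˡ (DI idSub) x₁x₁≋ m) (⊛-mono-coeff DIᶠ (2 ∷ []) H m ℕₚ.≤-refl)

  DI⊛x₁x₁x₂x₂ : (DI idSub ⊛ x₁x₁x₂x₂) m ≡ xᵉDI (2 ∷ 2 ∷ [])
  DI⊛x₁x₁x₂x₂ = trans (⊛-congˡ (DI idSub) x₁x₁x₂x₂≋ m) (⊛-mono-coeff DIᶠ (2 ∷ 2 ∷ []) H m ℕₚ.≤-refl)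

  DI⊛x₁x₁x₂x₂DS : (DI idSub ⊛ (x₁x₁x₂x₂ ⊛ DS (pairSub 2))) m ≡ x₁²x₂²DIDS
  DI⊛x₁x₁x₂x₂DS = begin
    (DI idSub ⊛ (x₁x₁x₂x₂ ⊛ DS (pairSub 2))) m
      ≡⟨ ⊛-congˡ (DI idSub) (⊛-congʳ (DS (pairSub 2)) x₁x₁x₂x₂≋) m ⟩
    (DI idSub ⊛ (mono (2 ∷ 2 ∷ []) ⊛ DS (pairSub 2))) m
      ≡⟨ ⊛-coeff DIᶠ (mono-⊛ᶠ (2 ∷ 2 ∷ []) (DS-family (pairSub 2) (pairSub-deg 2))) H m ℕₚ.≤-refl ⟩
    ∑[ t ∈ I ] ∑[ s ∈ filter (λ _ → true because ofʸ tt) (trees≤ H) ] c (addV (wI t) (addV (2 ∷ 2 ∷ []) (wPair 2 s)))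
      ≡⟨ ∑-cong I (λ t → cong (λ ts → ∑[ s ∈ ts ] c (addV (wI t) (addV (2 ∷ 2 ∷ []) (wPair 2 s)))) all-trees) ⟩
    x₁²x₂²DIDS ∎
    where
    open ≡-Reasoning
    all-trees = filter-all (λ _ → true because ofʸ tt) (All.universal (λ _ → tt) (trees≤ H))

  lhs-coefficient : (DI idSub ⊛ (oneS ⊝ X 0 ⊛ X 0 ⊕ X 0 ⊛ X 0 ⊛ X 1 ⊛ X 1 ⊝ X 0 ⊛ X 0 ⊛ X 1 ⊛ X 1 ⊛ DS (pairSub 2))) m
                    ≡ xᵉDI [] ℤ.- xᵉDI (2 ∷ []) ℤ.+ xᵉDI (2 ∷ 2 ∷ []) ℤ.- x₁²x₂²DIDS
  lhs-coefficient = begin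
    (DI idSub ⊛ (oneS ⊝ x₁x₁ ⊕ x₁x₁x₂x₂ ⊝ x₁x₁x₂x₂ ⊛ DS (pairSub 2))) m
      ≡⟨ ⊛-distribˡ-⊝ (DI idSub) (oneS ⊝ x₁x₁ ⊕ x₁x₁x₂x₂) (x₁x₁x₂x₂ ⊛ DS (pairSub 2)) m ⟩
    (DI idSub ⊛ (oneS ⊝ x₁x₁ ⊕ x₁x₁x₂x₂)) m ℤ.- (DI idSub ⊛ (x₁x₁x₂x₂ ⊛ DS (pairSub 2))) m
      ≡⟨ cong (ℤ._- DI⊛-DS-term) (⊛-distribˡ-⊕ (DI idSub) (oneS ⊝ x₁x₁) x₁x₁x₂x₂ m) ⟩
    (DI idSub ⊛ (oneS ⊝ x₁x₁)) m ℤ.+ (DI idSub ⊛ x₁x₁x₂x₂) m ℤ.- (DI idSub ⊛ (x₁x₁x₂x₂ ⊛ DS (pairSub 2))) m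
      ≡⟨ cong (λ z → z ℤ.+ (DI idSub ⊛ x₁x₁x₂x₂) m ℤ.- DI⊛-DS-term) (⊛-distribˡ-⊝ (DI idSub) oneS x₁x₁ m) ⟩
    (DI idSub ⊛ oneS) m ℤ.- (DI idSub ⊛ x₁x₁) m ℤ.+ (DI idSub ⊛ x₁x₁x₂x₂) m ℤ.- DI⊛-DS-term
      ≡⟨ cong₂ ℤ._-_ (cong₂ ℤ._+_ (cong₂ ℤ._-_ (⊛-mono-coeff DIᶠ [] H m ℕₚ.≤-refl) DI⊛x₁x₁) DI⊛x₁x₁x₂x₂)
                     DI⊛x₁x₁x₂x₂DS ⟩
    xᵉDI [] ℤ.- xᵉDI (2 ∷ []) ℤ.+ xᵉDI (2 ∷ 2 ∷ []) ℤ.- x₁²x₂²DIDS ∎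
    where
    open ≡-Reasoning
    DI⊛-DS-term = (DI idSub ⊛ (x₁x₁x₂x₂ ⊛ DS (pairSub 2))) m

  coefficients-agree : xᵉDI [] ℤ.- xᵉDI (2 ∷ []) ℤ.+ xᵉDI (2 ∷ 2 ∷ []) ℤ.- x₁²x₂²DIDS
                       ≡ c [] ℤ.+ c (1 ∷ []) ℤ.- c (1 ∷ 1 ∷ []) ℤ.+ x₁x₂DI
  coefficients-agree = ℤ-rearrange {A₁ = stems} {A₂ = brackets} {c₀ = c []} {c₁ = c (1 ∷ [])} {c₁₁ = c (1 ∷ 1 ∷ [])}
                                   DI-decomposition stems-identity brackets-identity

  rhs-coefficient : (oneS ⊕ X 0 ⊝ X 0 ⊛ X 1 ⊕ X 0 ⊛ X 1 ⊛ DI (pairSub 1)) m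
                    ≡ c [] ℤ.+ c (1 ∷ []) ℤ.- c (1 ∷ 1 ∷ []) ℤ.+ x₁x₂DI
  rhs-coefficient = cong₂ ℤ._+_
    (cong (ℤ._-_ (c [] ℤ.+ c (1 ∷ []))) (x₁x₂≋ m))
    (trans (⊛-congʳ (DI (pairSub 1)) x₁x₂≋ m)
           (coeff (mono-⊛ᶠ (1 ∷ 1 ∷ []) (DI-family (pairSub 1) (pairSub-deg 1))) H m ℕₚ.≤-refl))

theorem4p8 : DI idSub ⊛ (oneS ⊝ X 0 ⊛ X 0 ⊕ X 0 ⊛ X 0 ⊛ X 1 ⊛ X 1 ⊝ X 0 ⊛ X 0 ⊛ X 1 ⊛ X 1 ⊛ DS (pairSub 2)) ≋ oneS ⊕ X 0 ⊝ X 0 ⊛ X 1 ⊕ X 0 ⊛ X 1 ⊛ DI (pairSub 1)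
theorem4p8 m = trans lhs-coefficient (trans coefficients-agree (sym rhs-coefficient))
  where open Coefficients m
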